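{- Let $m\geqslant 2$ and $1\leqslant\ell<m$. If $\ell$ is odd, $\ell=2\ell'+1$ with $\ell'\geqslant 0$, then $b^{(1)}_{\mathbf{t}_m}(\ell)=m(1-\ell'-\ell'^2+\ell' m)$. If $\ell$ is even, then $b^{(1)}_{\mathbf{t}_m}(\ell)=\frac{m}{4}(6-\ell^2-2m+2\ell m)$.
   Context: $\mathcal{A}_m=\{0,\ldots,m-1\}=\mathbb{Z}/m\mathbb{Z}$; $\sigma_m$ is the morphism $\sigma_m(i)=i\,(i+1)\cdots(i+m-1)$ (letters mod $m$), and $\mathbf{t}_m=\lim_{j\to\infty}\sigma_m^j(0)$. $b^{(1)}_{\mathbf{t}_m}(n)$ is the abelian complexity of $\mathbf{t}_m$: the number of distinct Parikh vectors (vectors of letter counts) of factors (contiguous blocks) of length $n$ of $\mathbf{t}_m$. -}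

module Defs where

open import Data.Nat using (ℕ; zero; suc; _+_; _*_; _%_)
open import Data.List using (List; []; _∷_; map; concatMap; upTo; length)
open import Data.List.Membership.Propositional using (_∈_)
open import Data.List.Relation.Unary.All using (All)
open import Data.List.Relation.Unary.Unique.Propositional using (Unique)
open import Data.Product using (Σ; ∃; _×_)
open import Relation.Binary.PropositionalEquality using (_≡_)
open import Relation.Nullary using (Dec; yes; no)

-- reduction modulo m (letters of A_m = Z/mZ are represented by 0..m-1)
modN : ℕ → ℕ → ℕ
modN zero    x = x
modN (suc n) x = x % suc n

σ : ℕ → List ℕ → List ℕ
σ m = concatMap (λ i → map (λ k → modN m (i + k)) (upTo m))

iterate : {A : Set} → (A → A) → ℕ → A → A
iterate f zero    x = x
iterate f (suc j) x = f (iterate f j x)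

-- n-th element of a list (0-indexed), default 0 when out of range
nth : List ℕ → ℕ → ℕ
nth []       _       = 0
nth (x ∷ xs) zero    = x
nth (x ∷ xs) (suc n) = nth xs n

-- t_m = lim_j σ_m^j(0): the n-th letter is read off σ_m^(n+1)(0),
-- a prefix of t_m of length m^(n+1) > n (for m ≥ 2).
t : ℕ → ℕ → ℕ
t m n = nth (iterate (σ m) (suc n) (0 ∷ [])) n

factor : ℕ → ℕ → ℕ → List ℕ
factor m i n = map (λ j → t m (i + j)) (upTo n)

count : ℕ → List ℕ → ℕ
count a []       = 0
count a (x ∷ xs) with a Data.Nat.≟ x
... | yes _ = suc (count a xs)
... | no  _ = count a xs

parikh : ℕ → List ℕ → List ℕ
parikh m w = map (λ a → count a w) (upTo m)

-- "b^(1)_{t_m}(n) = k": the set of Parikh vectors of length-n factors of t_m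
-- has exactly k elements, witnessed by a duplicate-free list enumerating it.
HasAbelianComplexity : ℕ → ℕ → ℕ → Set
HasAbelianComplexity m n k =
  Σ (List (List ℕ)) λ L →
    length L ≡ k × Unique L
    × (∀ i → parikh m (factor m i n) ∈ L)
    × All (λ v → ∃ λ i → parikh m (factor m i n) ≡ v) L

-- A letter i of t_m expands under σ_m to the cyclic run i, i+1, …, i+m−1, so t_m(qm + r) = t_m(q) + r (mod m),
-- and every pair of letters occurs consecutively in t_m.  A factor of length ℓ < m thus meets at most two blocks,
-- and its Parikh vector is the sum of the indicator vectors of two cyclic intervals of ℤ/m with lengths adding up
-- to ℓ; conversely every such sum occurs.  Such a sum normalises to a single interval (m vectors), two disjoint
-- non-adjacent intervals (m(ℓ−1)(m−ℓ−1)/2 vectors) or an interval containing a shorter one (m⌊ℓ²/4⌋ vectors).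
-- Distinct normal forms give distinct vectors: v(a) − v(a−1) is the number of intervals starting at a minus the
-- number ending at a, and in a normal form no point is both a start and an end, so v determines all endpoints.

module Submission where

open import Defs
open import Data.Nat using (ℕ; _≤_; _<_; _+_; _*_)
open import Data.Product using (Σ; _×_)
open import Relation.Binary.PropositionalEquality using (_≡_)

open import Data.Nat using (zero; suc; _∸_; _%_; _/_; _≟_; _≤?_; _<?_; z≤n; s≤s; z<s)
open import Data.Nat.Properties
open import Data.Nat.DivMod
open import Data.Nat.ListAction using (sum)
open import Data.Nat.Tactic.RingSolver using (solve-∀)
open import Data.List using (List; []; _∷_; map; concatMap; upTo; length; applyUpTo; _++_)
open import Data.List.Properties using (length-++; length-map; length-upTo; length-applyUpTo; map-upTo; map-cong; concatMap-++)
open import Data.List.Membership.Propositional using (_∈_; find; lose)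
open import Data.List.Membership.Propositional.Properties
  using (∈-map⁺; ∈-map⁻; ∈-concatMap⁺; ∈-concatMap⁻; ∈-++⁺ˡ; ∈-++⁺ʳ; ∈-++⁻; ∈-upTo⁺; ∈-upTo⁻)
open import Data.List.Relation.Unary.Any using (here; there)
open import Data.List.Relation.Unary.All as All using (All)
import Data.List.Relation.Unary.All.Properties as AllP
open import Data.List.Relation.Unary.AllPairs using ([]; _∷_)
open import Data.List.Relation.Unary.Unique.Propositional using (Unique)
import Data.List.Relation.Unary.Unique.Propositional.Properties as Unique
open import Data.Product using (∃; ∃₂; _,_; proj₁; proj₂)
open import Data.Sum using (_⊎_; inj₁; inj₂)
open import Data.Empty using (⊥; ⊥-elim)
open import Function using (_∘_; _∘₂_; _⇔_; mk⇔; Equivalence)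
open import Relation.Binary.PropositionalEquality using (refl; sym; trans; cong; cong₂; subst; _≢_; ≢-sym; module ≡-Reasoning)
open import Relation.Binary.Definitions using (tri<; tri≈; tri>)
open import Relation.Nullary using (Dec; yes; no; ¬_; contradiction)

private
  variable
    A B : Set

nth-++ˡ : ∀ xs ys {n} → n < length xs → nth (xs ++ ys) n ≡ nth xs n
nth-++ˡ (x ∷ xs) ys {zero}  _         = refl
nth-++ˡ (x ∷ xs) ys {suc n} (s≤s n<) = nth-++ˡ xs ys n<

nth-++ʳ : ∀ xs ys n → nth (xs ++ ys) (length xs + n) ≡ nth ys n
nth-++ʳ []       ys n = refl
nth-++ʳ (x ∷ xs) ys n = nth-++ʳ xs ys n

nth-applyUpTo : ∀ f {n r} → r < n → nth (applyUpTo f n) r ≡ f r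
nth-applyUpTo f {suc n} {zero}  _         = refl
nth-applyUpTo f {suc n} {suc r} (s≤s r<) = nth-applyUpTo (f ∘ suc) r<

applyUpTo-cong : ∀ {f g : ℕ → A} n → (∀ {j} → j < n → f j ≡ g j) → applyUpTo f n ≡ applyUpTo g n
applyUpTo-cong zero    f≗g = refl
applyUpTo-cong (suc n) f≗g = cong₂ _∷_ (f≗g z<s) (applyUpTo-cong n (f≗g ∘ s≤s))

applyUpTo-+ : ∀ (f : ℕ → A) p n → applyUpTo f (p + n) ≡ applyUpTo f p ++ applyUpTo (λ j → f (p + j)) n
applyUpTo-+ f zero    n = refl
applyUpTo-+ f (suc p) n = cong (f 0 ∷_) (applyUpTo-+ (f ∘ suc) p n)

map-unique : ∀ {f : A → B} {xs} → (∀ {x y} → x ∈ xs → y ∈ xs → f x ≡ f y → x ≡ y) → Unique xs → Unique (map f xs)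
map-unique {xs = []}     _   []            = []
map-unique {xs = x ∷ xs} inj (x∉xs ∷ uxs) =
  AllP.map⁺ (All.tabulate λ y∈xs fx≡fy → All.lookup x∉xs y∈xs (inj (here refl) (there y∈xs) fx≡fy))
  ∷ map-unique (λ x∈ y∈ → inj (there x∈) (there y∈)) uxs

infixr 5 _⊗_
_⊗_ : List A → (A → List B) → List (A × B)
xs ⊗ f = concatMap (λ a → map (a ,_) (f a)) xs

∈-⊗⁺ : ∀ {xs} {f : A → List B} {a b} → a ∈ xs → b ∈ f a → (a , b) ∈ xs ⊗ f
∈-⊗⁺ {f = f} a∈xs b∈fa = ∈-concatMap⁺ (λ a → map (a ,_) (f a)) (lose a∈xs (∈-map⁺ (_ ,_) b∈fa))

∈-⊗⁻ : ∀ xs {f : A → List B} {a b} → (a , b) ∈ xs ⊗ f → a ∈ xs × b ∈ f a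
∈-⊗⁻ xs {f} ab∈ with find (∈-concatMap⁻ (λ a → map (a ,_) (f a)) {xs = xs} ab∈)
... | a′ , a′∈xs , ab∈′ with ∈-map⁻ (a′ ,_) ab∈′
... | b′ , b′∈ , refl = a′∈xs , b′∈

⊗-unique : ∀ {xs} {f : A → List B} → Unique xs → (∀ a → Unique (f a)) → Unique (xs ⊗ f)
⊗-unique {xs = []}     _             _  = []
⊗-unique {xs = x ∷ xs} {f} (x∉xs ∷ uxs) uf =
  Unique.++⁺ (Unique.map⁺ (cong proj₂) (uf x)) (⊗-unique uxs uf) disjoint
  where
  disjoint : ∀ {v} → ¬ (v ∈ map (x ,_) (f x) × v ∈ xs ⊗ f)
  disjoint (v∈here , v∈rest) with ∈-map⁻ (x ,_) v∈here
  ... | _ , _ , refl = All.lookup x∉xs (proj₁ (∈-⊗⁻ xs v∈rest)) refl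

length-⊗ : ∀ xs (f : A → List B) → length (xs ⊗ f) ≡ sum (map (length ∘ f) xs)
length-⊗ []       f = refl
length-⊗ (x ∷ xs) f = trans (length-++ (map (x ,_) (f x))) (cong₂ _+_ (length-map (x ,_) (f x)) (length-⊗ xs f))

δ : ℕ → ℕ → ℕ
δ a b = count a (b ∷ [])

count-++ : ∀ a xs ys → count a (xs ++ ys) ≡ count a xs + count a ys
count-++ a []       ys = refl
count-++ a (x ∷ xs) ys with a ≟ x
... | yes _ = cong suc (count-++ a xs ys)
... | no  _ = count-++ a xs ys

count-∷ : ∀ a b xs → count a (b ∷ xs) ≡ δ a b + count a xs
count-∷ a b = count-++ a (b ∷ [])

δ-refl : ∀ a → δ a a ≡ 1
δ-refl a with a ≟ a
... | yes _  = refl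
... | no a≢a = ⊥-elim (a≢a refl)

δ-≢ : ∀ {a b} → a ≢ b → δ a b ≡ 0
δ-≢ {a} {b} a≢b with a ≟ b
... | yes a≡b = ⊥-elim (a≢b a≡b)
... | no  _   = refl

δ≤1 : ∀ a b → δ a b ≤ 1
δ≤1 a b with a ≟ b
... | yes _ = ≤-refl
... | no  _ = z≤n

δ>0⇒≡ : ∀ {a b} → 0 < δ a b → a ≡ b
δ>0⇒≡ {a} {b} δ>0 with a ≟ b
... | yes a≡b = a≡b
δ>0⇒≡ {a} {b} () | no _

δ-⇔ : ∀ {a b a′ b′} → a ≡ b ⇔ a′ ≡ b′ → δ a b ≡ δ a′ b′
δ-⇔ {a} {b} {a′} {b′} a≡b⇔ with a ≟ b | a′ ≟ b′
... | yes _   | yes _    = refl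
... | no  _   | no  _    = refl
... | yes a≡b | no a′≢b′ = ⊥-elim (a′≢b′ (Equivalence.to a≡b⇔ a≡b))
... | no a≢b  | yes a′≡b′ = ⊥-elim (a≢b (Equivalence.from a≡b⇔ a′≡b′))

count-applyUpTo-⇔ : ∀ {a b} f g n → (∀ j → a ≡ f j ⇔ b ≡ g j) →
                    count a (applyUpTo f n) ≡ count b (applyUpTo g n)
count-applyUpTo-⇔ {a} {b} f g zero    f⇔g = refl
count-applyUpTo-⇔ {a} {b} f g (suc n) f⇔g = begin
  count a (applyUpTo f (suc n))                   ≡⟨ count-∷ a (f 0) _ ⟩
  δ a (f 0) + count a (applyUpTo (f ∘ suc) n)     ≡⟨ cong₂ _+_ (δ-⇔ (f⇔g 0)) (count-applyUpTo-⇔ (f ∘ suc) (g ∘ suc) n (f⇔g ∘ suc)) ⟩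
  δ b (g 0) + count b (applyUpTo (g ∘ suc) n)     ≡⟨ count-∷ b (g 0) _ ⟨
  count b (applyUpTo g (suc n))                   ∎
  where open ≡-Reasoning

disjoint-cancel : ∀ {S E S′ E′} → S + E′ ≡ S′ + E → S ≡ 0 ⊎ E ≡ 0 → S′ ≡ 0 ⊎ E′ ≡ 0 → S ≡ S′ × E ≡ E′
disjoint-cancel {S}     eq (inj₁ refl) (inj₁ refl) = refl , sym eq
disjoint-cancel {S′ = S′} eq (inj₁ refl) (inj₂ refl) = sym (m+n≡0⇒m≡0 S′ (sym eq)) , m+n≡0⇒n≡0 S′ (sym eq)
disjoint-cancel {S}     eq (inj₂ refl) (inj₁ refl) = m+n≡0⇒m≡0 S eq , sym (m+n≡0⇒n≡0 S eq)
disjoint-cancel {S} {S′ = S′} eq (inj₂ refl) (inj₂ refl) = trans (sym (+-identityʳ S)) (trans eq (+-identityʳ S′)) , refl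

δ-disjoint : ∀ {P Q} → P ≢ Q → ∀ a → δ a P ≡ 0 ⊎ δ a Q ≡ 0
δ-disjoint {P} {Q} P≢Q a = split (a ≟ P)
  where
  split : Dec (a ≡ P) → δ a P ≡ 0 ⊎ δ a Q ≡ 0
  split (yes refl) = inj₂ (δ-≢ P≢Q)
  split (no a≢P)   = inj₁ (δ-≢ a≢P)

δ₂-disjoint : ∀ {P₁ P₂ Q₁ Q₂} → P₁ ≢ Q₁ → P₁ ≢ Q₂ → P₂ ≢ Q₁ → P₂ ≢ Q₂ →
              ∀ a → δ a P₁ + δ a P₂ ≡ 0 ⊎ δ a Q₁ + δ a Q₂ ≡ 0
δ₂-disjoint {P₁} {P₂} {Q₁} {Q₂} P₁≢Q₁ P₁≢Q₂ P₂≢Q₁ P₂≢Q₂ a = split (a ≟ P₁) (a ≟ P₂)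
  where
  split : Dec (a ≡ P₁) → Dec (a ≡ P₂) → δ a P₁ + δ a P₂ ≡ 0 ⊎ δ a Q₁ + δ a Q₂ ≡ 0
  split (yes refl) _          = inj₂ (cong₂ _+_ (δ-≢ P₁≢Q₁) (δ-≢ P₁≢Q₂))
  split (no _)     (yes refl) = inj₂ (cong₂ _+_ (δ-≢ P₂≢Q₁) (δ-≢ P₂≢Q₂))
  split (no a≢P₁)  (no a≢P₂)  = inj₁ (cong₂ _+_ (δ-≢ a≢P₁) (δ-≢ a≢P₂))

δ-injective : ∀ {M P Q} → P < M → (∀ a → a < M → δ a P ≡ δ a Q) → P ≡ Q
δ-injective {P = P} P<M δ≡ = δ>0⇒≡ (subst (0 <_) (trans (sym (δ-refl P)) (δ≡ P P<M)) z<s)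

δ≢δ+δ : ∀ {M P Q₁ Q₂} → Q₁ < M → Q₂ < M → ¬ (∀ a → a < M → δ a P ≡ δ a Q₁ + δ a Q₂)
δ≢δ+δ {P = P} {Q₁} {Q₂} Q₁<M Q₂<M δ≡ = <-irrefl refl (≤-trans (≤-reflexive (sym δQ₁P≡2)) (δ≤1 Q₁ P))
  where
  δQ₁P≡ : δ Q₁ P ≡ suc (δ Q₁ Q₂)
  δQ₁P≡ = trans (δ≡ Q₁ Q₁<M) (cong (_+ δ Q₁ Q₂) (δ-refl Q₁))
  δQ₂P≡ : δ Q₂ P ≡ δ Q₂ Q₁ + 1
  δQ₂P≡ = trans (δ≡ Q₂ Q₂<M) (cong (δ Q₂ Q₁ +_) (δ-refl Q₂))
  Q₁≡P : Q₁ ≡ P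
  Q₁≡P = δ>0⇒≡ (subst (0 <_) (sym δQ₁P≡) z<s)
  Q₂≡P : Q₂ ≡ P
  Q₂≡P = δ>0⇒≡ (subst (0 <_) (trans (+-comm 1 _) (sym δQ₂P≡)) z<s)
  δQ₁P≡2 : δ Q₁ P ≡ 2
  δQ₁P≡2 = trans δQ₁P≡ (cong suc (trans (cong (δ Q₁) (trans Q₂≡P (sym Q₁≡P))) (δ-refl Q₁)))

δ+δ-injective : ∀ {M P₁ P₂ Q₁ Q₂} → P₁ < M → P₂ < M → (∀ a → a < M → δ a P₁ + δ a P₂ ≡ δ a Q₁ + δ a Q₂) →
                (P₁ ≡ Q₁ × P₂ ≡ Q₂) ⊎ (P₁ ≡ Q₂ × P₂ ≡ Q₁)
δ+δ-injective {P₁ = P₁} {P₂} {Q₁} {Q₂} P₁<M P₂<M δ≡ with P₁ ≟ Q₁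
... | yes refl = inj₁ (refl , δ-injective P₂<M λ a a<m → +-cancelˡ-≡ (δ a P₁) _ _ (δ≡ a a<m))
... | no P₁≢Q₁ = inj₂ (P₁≡Q₂ , δ-injective P₂<M λ a a<m → +-cancelˡ-≡ (δ a P₁) _ _
                   (trans (δ≡ a a<m) (trans (+-comm (δ a Q₁) _) (cong (λ z → δ a z + δ a Q₁) (sym P₁≡Q₂)))))
  where
  P₁≡Q₂ : P₁ ≡ Q₂
  P₁≡Q₂ = δ>0⇒≡ (subst (0 <_) (trans (cong (_+ δ P₁ P₂) (sym (δ-refl P₁)))
                   (trans (δ≡ P₁ P₁<M) (cong (_+ δ P₁ Q₂) (δ-≢ P₁≢Q₁)))) z<s)

cross-cancel : ∀ X Y {S E S′ E′} → X + E ≡ S + Y → X + E′ ≡ S′ + Y → S + E′ ≡ S′ + E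
cross-cancel X Y {S} {E} {S′} {E′} eq eq′ = +-cancelʳ-≡ (X + Y) _ _ (begin
  S + E′ + (X + Y)        ≡⟨ shuffle S E′ X Y ⟩
  (S + Y) + (X + E′)      ≡⟨ cong₂ _+_ (sym eq) eq′ ⟩
  (X + E) + (S′ + Y)      ≡⟨ unshuffle X E S′ Y ⟩
  S′ + E + (X + Y)        ∎)
  where
  open ≡-Reasoning
  shuffle : ∀ S E X Y → S + E + (X + Y) ≡ (S + Y) + (X + E)
  shuffle = solve-∀
  unshuffle : ∀ X E S Y → (X + E) + (S + Y) ≡ S + E + (X + Y)
  unshuffle = solve-∀

-- Most lemmas below name the slack of each hypothesis with m≤n⇒∃[o]m+o≡n, which turns every claim into a ring identity.
<-witness : ∀ {a b} w → b ≡ suc (a + w) → a < b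
<-witness {a} w refl = s≤s (m≤m+n a w)

≤-witness : ∀ {a b} w → b ≡ a + w → a ≤ b
≤-witness {a} w refl = m≤m+n a w

∸-witness : ∀ {a b} c → a ≡ b + c → a ∸ c ≡ b
∸-witness {b = b} c refl = m+n∸n≡m b c

apart-parameters : ∀ M L s α D p → s + D < M → 1 ≤ α → α + suc p ≡ L → α < D → D + suc p < M →
                   let q = M ∸ suc (D + suc p) in
                   suc p < L × suc (L + q) < M × s < p + q + 2 × L ∸ suc p ≡ α × M ∸ (p + q + 2) ≡ D
apart-parameters M L s (suc a) D p s+D<M (s≤s z≤n) refl α<D D+β<M with m≤n⇒∃[o]m+o≡n α<D
... | v , refl with m≤n⇒∃[o]m+o≡n D+β<M
... | w , refl rewrite m+n∸m≡n (suc (suc (suc a + v) + suc p)) w =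
    <-witness a (e₁ a p)
  , <-witness v (e₂ a p w v)
  , +-cancelʳ-< (suc (suc a + v)) s (p + w + 2) (subst (s + suc (suc a + v) <_) (e₃ a p w v) s+D<M)
  , ∸-witness (suc p) refl
  , ∸-witness (p + w + 2) (e₄ a p w v)
  where
  e₁ : ∀ a p → suc a + suc p ≡ suc (suc p + a)
  e₁ = solve-∀
  e₂ : ∀ a p w v → suc (suc (suc a + v) + suc p) + w ≡ suc (suc (suc a + suc p + w) + v)
  e₂ = solve-∀
  e₃ : ∀ a p w v → suc (suc (suc a + v) + suc p) + w ≡ p + w + 2 + suc (suc a + v)
  e₃ = solve-∀
  e₄ : ∀ a p w v → suc (suc (suc a + v) + suc p) + w ≡ suc (suc a + v) + (p + w + 2)
  e₄ = solve-∀

apart-geometry : ∀ M L p q s → suc p < L → suc (L + q) < M → s < p + q + 2 →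
                 let α = L ∸ suc p ; D = M ∸ (p + q + 2) in
                 1 ≤ α × α < D × D + suc p < M × s + D < M
apart-geometry M L p q s β<L L+q<M s< with m≤n⇒∃[o]m+o≡n β<L
... | a , refl with m≤n⇒∃[o]m+o≡n L+q<M
... | w , refl = geometry (∸-witness (suc p) (e₀ p a)) (∸-witness (p + q + 2) (e₁ p q a w))
  where
  M′ : ℕ
  M′ = suc (suc (suc (suc p) + a + q)) + w
  e₀ : ∀ p a → suc (suc p) + a ≡ suc a + suc p
  e₀ = solve-∀
  e₁ : ∀ p q a w → suc (suc (suc (suc p) + a + q)) + w ≡ suc (suc (a + w)) + (p + q + 2)
  e₁ = solve-∀
  e₂ : ∀ a w → suc (suc (a + w)) ≡ suc (suc a + w)
  e₂ = solve-∀
  e₃ : ∀ a p q w → suc (suc (suc (suc p) + a + q)) + w ≡ suc (suc (suc (a + w)) + suc p + q)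
  e₃ = solve-∀
  e₄ : ∀ a p q w → p + q + 2 + suc (suc (a + w)) ≡ suc (suc (suc (suc p) + a + q)) + w
  e₄ = solve-∀
  geometry : ∀ {α D} → α ≡ suc a → D ≡ suc (suc (a + w)) → 1 ≤ α × α < D × D + suc p < M′ × s + D < M′
  geometry refl refl =
      s≤s z≤n
    , <-witness w (e₂ a w)
    , <-witness q (e₃ a p q w)
    , subst (s + suc (suc (a + w)) <_) (e₄ a p q w) (+-monoˡ-< (suc (suc (a + w))) s<)

nested-parameters-inside : ∀ L d k′ i → d + suc i ≤ k′ → k′ + suc i ≡ L → d + suc (i + i) < L × L ∸ suc i ≡ k′
nested-parameters-inside L d k′ i d+w≤k′ refl with m≤n⇒∃[o]m+o≡n d+w≤k′
... | w , refl = <-witness w (e d i w) , ∸-witness (suc i) refl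
  where
  e : ∀ d i w → d + suc i + w + suc i ≡ suc (d + suc (i + i) + w)
  e = solve-∀

nested-parameters-overhang : ∀ L d i j → suc i < j → d + suc i + j ≡ L → d + suc (i + i) < L × L ∸ suc i ≡ d + j
nested-parameters-overhang L d i j w<j refl with m≤n⇒∃[o]m+o≡n w<j
... | w , refl = <-witness (suc w) (e₁ d i w) , ∸-witness (suc i) (e₂ d i w)
  where
  e₁ : ∀ d i w → d + suc i + (suc (suc i) + w) ≡ suc (d + suc (i + i) + suc w)
  e₁ = solve-∀
  e₂ : ∀ d i w → d + suc i + (suc (suc i) + w) ≡ d + (suc (suc i) + w) + suc i
  e₂ = solve-∀

nested-geometry : ∀ M L i o → o + suc (i + i) < L → L < M →
                  let u = L ∸ suc i in o + suc i ≤ u × u < M × u + suc i ≡ L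
nested-geometry M L i o fits L<M with m≤n⇒∃[o]m+o≡n fits
... | a , refl = ≤-witness a (∸-witness (suc i) (e₁ o i a))
               , ≤-<-trans (m∸n≤m _ (suc i)) L<M
               , m∸n+n≡m (≤-witness (o + i + suc a) (e₂ o i a))
  where
  e₁ : ∀ o i a → suc (o + suc (i + i)) + a ≡ o + suc i + a + suc i
  e₁ = solve-∀
  e₂ : ∀ o i a → suc (o + suc (i + i)) + a ≡ suc i + (o + i + suc a)
  e₂ = solve-∀

∸-wrap : ∀ M x d → M ≤ x + d → d ≤ M → (x + d ∸ M) + (M ∸ d) ≡ x
∸-wrap M x d M≤x+d d≤M with m≤n⇒∃[o]m+o≡n d≤M
... | w , refl with m≤n⇒∃[o]m+o≡n (+-cancelʳ-≤ d w x (subst (_≤ x + d) (+-comm d w) M≤x+d))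
... | v , refl = trans (cong₂ _+_ (∸-witness (d + w) (e w v d)) (m+n∸m≡n d w)) (+-comm v w)
  where
  e : ∀ w v d → w + v + d ≡ v + (d + w)
  e = solve-∀

∸-+-< : ∀ M d k′ → k′ < d → d ≤ M → (M ∸ d) + k′ < M
∸-+-< M d k′ k′<d d≤M with m≤n⇒∃[o]m+o≡n d≤M
... | w , refl with m≤n⇒∃[o]m+o≡n k′<d
... | v , refl = <-witness v (trans (e k′ v w) (cong (λ z → suc (z + k′ + v)) (sym (m+n∸m≡n (suc k′ + v) w))))
  where
  e : ∀ k′ v w → suc k′ + v + w ≡ suc (w + k′ + v)
  e = solve-∀

∸-<-overhang : ∀ M d j → M < d + j → d ≤ M → M ∸ d < j
∸-<-overhang M d j M<d+j d≤M = +-cancelˡ-< d (M ∸ d) j (subst (_< d + j) (sym (m+[n∸m]≡n d≤M)) M<d+j)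

shifted-lengths : ∀ {u w u′ w′ o o′} → u + w ≡ u′ + w′ → o′ ≤ u′ → u ≡ u′ ∸ o′ → o + w ≡ w′ → o + o′ ≡ 0
shifted-lengths {u} {w} {u′} {w′} {o} {o′} total o′≤u′ refl refl with m≤n⇒∃[o]m+o≡n o′≤u′
... | v , refl = +-cancelˡ-≡ (v + w) (o + o′) 0 (begin
  v + w + (o + o′)        ≡⟨ rearrange v w o o′ ⟩
  (o′ + v) + (o + w)      ≡⟨ total ⟨
  o′ + v ∸ o′ + w         ≡⟨ cong (_+ w) (m+n∸m≡n o′ v) ⟩
  v + w                   ≡⟨ +-identityʳ (v + w) ⟨
  v + w + 0               ∎)
  where
  open ≡-Reasoning
  rearrange : ∀ v w o o′ → v + w + (o + o′) ≡ (o′ + v) + (o + w)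
  rearrange = solve-∀

∸-fits⇒< : ∀ {o w u o′} → o′ ≤ u → o + suc w ≡ u ∸ o′ → o + o′ < u
∸-fits⇒< {o} {w} {u} {o′} o′≤u o+w≡ = begin-strict
  o + o′                  <⟨ +-monoˡ-< o′ (m<m+n o z<s) ⟩
  o + suc w + o′          ≡⟨ cong (_+ o′) o+w≡ ⟩
  u ∸ o′ + o′             ≡⟨ m∸n+n≡m o′≤u ⟩
  u                       ∎
  where open ≤-Reasoning

module Modular (n : ℕ) where
  m : ℕ
  m = suc n

  infixl 6 _⊕_
  _⊕_ : ℕ → ℕ → ℕ
  x ⊕ j = (x + j) % m

  ⊕<m : ∀ x j → x ⊕ j < m
  ⊕<m x j = m%n<n (x + j) m

  %-absorbˡ : ∀ a b → (a % m + b) % m ≡ (a + b) % m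
  %-absorbˡ a b = begin
    (a % m + b) % m              ≡⟨ %-distribˡ-+ (a % m) b m ⟩
    (a % m % m + b % m) % m      ≡⟨ cong (λ z → (z + b % m) % m) (m%n%n≡m%n a m) ⟩
    (a % m + b % m) % m          ≡⟨ %-distribˡ-+ a b m ⟨
    (a + b) % m                  ∎
    where open ≡-Reasoning

  %-absorbʳ : ∀ a b → (a + b % m) % m ≡ (a + b) % m
  %-absorbʳ a b = begin
    (a + b % m) % m   ≡⟨ cong (_% m) (+-comm a (b % m)) ⟩
    (b % m + a) % m   ≡⟨ %-absorbˡ b a ⟩
    (b + a) % m       ≡⟨ cong (_% m) (+-comm b a) ⟩
    (a + b) % m       ∎
    where open ≡-Reasoning

  ⊕-assoc : ∀ x i j → x ⊕ i ⊕ j ≡ x ⊕ (i + j)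
  ⊕-assoc x i j = trans (%-absorbˡ (x + i) j) (cong (_% m) (+-assoc x i j))

  ⊕-exact : ∀ x j → x + j < m → x ⊕ j ≡ x + j
  ⊕-exact x j = m<n⇒m%n≡m

  ⊕-identityʳ : ∀ {x} → x < m → x ⊕ 0 ≡ x
  ⊕-identityʳ {x} x<m = trans (cong (_% m) (+-identityʳ x)) (m<n⇒m%n≡m x<m)

  ⊕-wrap : ∀ x j → x ⊕ (m + j) ≡ x ⊕ j
  ⊕-wrap x j = begin
    (x + (m + j)) % m   ≡⟨ cong (λ y → (x + y) % m) (+-comm m j) ⟩
    (x + (j + m)) % m   ≡⟨ cong (_% m) (+-assoc x j m) ⟨
    (x + j + m) % m     ≡⟨ [m+n]%n≡m%n (x + j) m ⟩
    (x + j) % m         ∎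
    where open ≡-Reasoning

  ⊕-complement : ∀ x {d} → d ≤ m → x ⊕ d ⊕ (m ∸ d) ≡ x % m
  ⊕-complement x {d} d≤m = begin
    x ⊕ d ⊕ (m ∸ d)      ≡⟨ ⊕-assoc x d (m ∸ d) ⟩
    x ⊕ (d + (m ∸ d))    ≡⟨ cong (x ⊕_) (m+[n∸m]≡n d≤m) ⟩
    (x + m) % m          ≡⟨ [m+n]%n≡m%n x m ⟩
    x % m                ∎
    where open ≡-Reasoning

  ⊕-inverse : ∀ x {i} → i < m → x ⊕ i ⊕ (m ∸ x % m) ≡ i
  ⊕-inverse x {i} i<m = begin
    x ⊕ i ⊕ (m ∸ r)                   ≡⟨ ⊕-assoc x i (m ∸ r) ⟩
    (x + (i + (m ∸ r))) % m           ≡⟨ cong (λ y → (y + (i + (m ∸ r))) % m) (m≡m%n+[m/n]*n x m) ⟩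
    (r + q * m + (i + (m ∸ r))) % m   ≡⟨ cong (_% m) (shuffle r (q * m) i (m ∸ r)) ⟩
    (i + (r + (m ∸ r)) + q * m) % m   ≡⟨ cong (λ y → (i + y + q * m) % m) (m+[n∸m]≡n (<⇒≤ (m%n<n x m))) ⟩
    (i + m + q * m) % m               ≡⟨ cong (_% m) (+-assoc i m (q * m)) ⟩
    (i + suc q * m) % m               ≡⟨ [m+kn]%n≡m%n i (suc q) m ⟩
    i % m                             ≡⟨ m<n⇒m%n≡m i<m ⟩
    i                                 ∎
    where
    open ≡-Reasoning
    r q : ℕ
    r = x % m
    q = x / m
    shuffle : ∀ a b c d → a + b + (c + d) ≡ c + (a + d) + b
    shuffle = solve-∀

  ⊕-cancelˡ : ∀ x {i j} → i < m → j < m → x ⊕ i ≡ x ⊕ j → i ≡ j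
  ⊕-cancelˡ x i<m j<m eq = begin
    _                    ≡⟨ ⊕-inverse x i<m ⟨
    x ⊕ _ ⊕ (m ∸ x % m)  ≡⟨ cong (_⊕ (m ∸ x % m)) eq ⟩
    x ⊕ _ ⊕ (m ∸ x % m)  ≡⟨ ⊕-inverse x j<m ⟩
    _                    ∎
    where open ≡-Reasoning

  ⊕-≢ : ∀ s {i j} → i < m → j < m → i ≢ j → s ⊕ i ≢ s ⊕ j
  ⊕-≢ s i<m j<m i≢j = i≢j ∘ ⊕-cancelˡ s i<m j<m

  ⊕-period : ∀ x {i j} → i < m → j < m → x ⊕ (i + j) ≡ x ⊕ 0 → i + j ≡ 0 ⊎ i + j ≡ m
  ⊕-period x {i} {j} i<m j<m eq with i + j <? m
  ... | yes i+j<m = inj₁ (⊕-cancelˡ x i+j<m z<s eq)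
  ... | no i+j≮m = inj₂ (begin
    i + j                  ≡⟨ m+[n∸m]≡n m≤i+j ⟨
    m + (i + j ∸ m)        ≡⟨ cong (m +_) excess≡0 ⟩
    m + 0                  ≡⟨ +-identityʳ m ⟩
    m                      ∎)
    where
    open ≡-Reasoning
    m≤i+j : m ≤ i + j
    m≤i+j = ≮⇒≥ i+j≮m
    excess≡0 : i + j ∸ m ≡ 0
    excess≡0 = ⊕-cancelˡ x (m<n+o⇒m∸n<o (i + j) m (+-mono-< i<m j<m)) z<s (begin
      x ⊕ (i + j ∸ m)        ≡⟨ ⊕-wrap x (i + j ∸ m) ⟨
      x ⊕ (m + (i + j ∸ m))  ≡⟨ cong (x ⊕_) (m+[n∸m]≡n m≤i+j) ⟩
      x ⊕ (i + j)            ≡⟨ eq ⟩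
      x ⊕ 0                  ∎)

  wraps-around : ∀ x {o d} → x < m → o < m → 1 ≤ d → d < m → x ⊕ o + d ≡ x → o + d ≡ m
  wraps-around x {o} {d} x<m o<m 1≤d d<m eq with ⊕-period x o<m d<m (begin
    x ⊕ (o + d)    ≡⟨ ⊕-assoc x o d ⟨
    x ⊕ o ⊕ d      ≡⟨ cong (_% m) eq ⟩
    x % m          ≡⟨ cong (_% m) (+-identityʳ x) ⟨
    x ⊕ 0          ∎)
    where open ≡-Reasoning
  ... | inj₁ o+d≡0 = contradiction (m+n≡0⇒n≡0 o o+d≡0) (≢-sym (<⇒≢ 1≤d))
  ... | inj₂ o+d≡m = o+d≡m

  offset : ℕ → ℕ → ℕ
  offset x y = (y + (m ∸ x % m)) % m

  offset<m : ∀ x y → offset x y < m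
  offset<m x y = m%n<n (y + (m ∸ x % m)) m

  ⊕-offset : ∀ x y → x % m ⊕ offset x y ≡ y % m
  ⊕-offset x y = begin
    (r + (y + (m ∸ r)) % m) % m   ≡⟨ %-absorbʳ r (y + (m ∸ r)) ⟩
    (r + (y + (m ∸ r))) % m       ≡⟨ cong (_% m) (rearrange r y (m ∸ r)) ⟩
    (y + (r + (m ∸ r))) % m       ≡⟨ cong (λ z → (y + z) % m) (m+[n∸m]≡n (<⇒≤ (m%n<n x m))) ⟩
    (y + m) % m                   ≡⟨ [m+n]%n≡m%n y m ⟩
    y % m                         ∎
    where
    open ≡-Reasoning
    r : ℕ
    r = x % m
    rearrange : ∀ r y d → r + (y + d) ≡ y + (r + d)
    rearrange = solve-∀

  prev : ℕ → ℕ
  prev a = a ⊕ n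

  prev<m : ∀ a → prev a < m
  prev<m a = ⊕<m a n

  ≡suc⇔prev≡ : ∀ {a} z → a < m → a ≡ suc z % m ⇔ prev a ≡ z % m
  ≡suc⇔prev≡ {a} z a<m = mk⇔ to from
    where
    open ≡-Reasoning
    to : a ≡ suc z % m → prev a ≡ z % m
    to refl = begin
      (suc z % m + n) % m   ≡⟨ %-absorbˡ (suc z) n ⟩
      (suc z + n) % m       ≡⟨ cong (_% m) (+-suc z n) ⟨
      (z + m) % m           ≡⟨ [m+n]%n≡m%n z m ⟩
      z % m                 ∎
    from : prev a ≡ z % m → a ≡ suc z % m
    from eq = sym (begin
      suc z % m             ≡⟨ %-absorbʳ 1 z ⟨
      (1 + z % m) % m       ≡⟨ cong (λ y → (1 + y) % m) eq ⟨
      (1 + (a + n) % m) % m ≡⟨ %-absorbʳ 1 (a + n) ⟩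
      (suc a + n) % m       ≡⟨ cong (_% m) (+-suc a n) ⟨
      (a + m) % m           ≡⟨ [m+n]%n≡m%n a m ⟩
      a % m                 ≡⟨ m<n⇒m%n≡m a<m ⟩
      a                     ∎)

  arc : ℕ → ℕ → ℕ → ℕ
  arc x ℓ a = count a (applyUpTo (x ⊕_) ℓ)

  arc-cong : ∀ x y ℓ a → x % m ≡ y % m → arc x ℓ a ≡ arc y ℓ a
  arc-cong x y ℓ a eq = cong (count a) (applyUpTo-cong ℓ λ {j} _ → begin
    (x + j) % m       ≡⟨ %-absorbˡ x j ⟨
    (x % m + j) % m   ≡⟨ cong (λ z → (z + j) % m) eq ⟩
    (y % m + j) % m   ≡⟨ %-absorbˡ y j ⟩
    (y + j) % m       ∎)
    where open ≡-Reasoning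

  arc-+ : ∀ x p ℓ a → arc x (p + ℓ) a ≡ arc x p a + arc (x + p) ℓ a
  arc-+ x p ℓ a = begin
    count a (applyUpTo (x ⊕_) (p + ℓ))
      ≡⟨ cong (count a) (applyUpTo-+ (x ⊕_) p ℓ) ⟩
    count a (applyUpTo (x ⊕_) p ++ applyUpTo (λ j → x ⊕ (p + j)) ℓ)
      ≡⟨ count-++ a (applyUpTo (x ⊕_) p) _ ⟩
    arc x p a + count a (applyUpTo (λ j → x ⊕ (p + j)) ℓ)
      ≡⟨ cong (λ w → arc x p a + count a w) (applyUpTo-cong ℓ λ {j} _ → cong (_% m) (+-assoc x p j)) ⟨
    arc x p a + arc (x + p) ℓ a
      ∎
    where open ≡-Reasoning

  arc-join : ∀ y j x k a → (y + j) % m ≡ x % m → arc y j a + arc x k a ≡ arc y (j + k) a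
  arc-join y j x k a y+j≡x = trans (cong (arc y j a +_) (arc-cong x (y + j) k a (sym y+j≡x))) (sym (arc-+ y j k a))

  arc-suc : ∀ x ℓ a → arc x (suc ℓ) a ≡ δ a (x ⊕ 0) + arc (suc x) ℓ a
  arc-suc x ℓ a = trans (count-∷ a (x ⊕ 0) _)
    (cong (λ w → δ a (x ⊕ 0) + count a w) (applyUpTo-cong ℓ λ {j} _ → cong (_% m) (+-suc x j)))

  arc-rotate : ∀ x ℓ {a} → a < m → arc (suc x) ℓ a ≡ arc x ℓ (prev a)
  arc-rotate x ℓ a<m = count-applyUpTo-⇔ _ _ ℓ λ j → ≡suc⇔prev≡ (x + j) a<m

  arc-boundary : ∀ x ℓ {a} → a < m → arc x ℓ a + δ a (x ⊕ ℓ) ≡ δ a (x ⊕ 0) + arc x ℓ (prev a)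
  arc-boundary x ℓ {a} a<m = begin
    arc x ℓ a + δ a (x ⊕ ℓ)                ≡⟨ cong (λ y → arc x ℓ a + δ a (y % m)) (+-identityʳ (x + ℓ)) ⟨
    arc x ℓ a + arc (x + ℓ) 1 a            ≡⟨ arc-+ x ℓ 1 a ⟨
    arc x (ℓ + 1) a                        ≡⟨ cong (λ k → arc x k a) (+-comm ℓ 1) ⟩
    arc x (suc ℓ) a                        ≡⟨ arc-suc x ℓ a ⟩
    δ a (x ⊕ 0) + arc (suc x) ℓ a          ≡⟨ cong (δ a (x ⊕ 0) +_) (arc-rotate x ℓ a<m) ⟩
    δ a (x ⊕ 0) + arc x ℓ (prev a)         ∎
    where open ≡-Reasoning

module Sequence (k : ℕ) where
  open Modular (suc k) public

  block : ℕ → List ℕ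
  block i = map (λ j → modN m (i + j)) (upTo m)

  block≡ : ∀ i → block i ≡ applyUpTo (i ⊕_) m
  block≡ i = map-upTo (i ⊕_) m

  length-block : ∀ i → length (block i) ≡ m
  length-block i = trans (cong length (block≡ i)) (length-applyUpTo (i ⊕_) m)

  length-σ : ∀ w → length (σ m w) ≡ length w * m
  length-σ []      = refl
  length-σ (x ∷ w) = trans (length-++ (block x)) (cong₂ _+_ (length-block x) (length-σ w))

  nth-σ : ∀ w {q r} → q < length w → r < m → nth (σ m w) (q * m + r) ≡ nth w q ⊕ r
  nth-σ (x ∷ w) {zero} {r} _ r<m = begin
    nth (block x ++ σ m w) r  ≡⟨ nth-++ˡ (block x) (σ m w) (subst (r <_) (sym (length-block x)) r<m) ⟩
    nth (block x) r           ≡⟨ cong (λ b → nth b r) (block≡ x) ⟩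
    nth (applyUpTo (x ⊕_) m) r ≡⟨ nth-applyUpTo (x ⊕_) r<m ⟩
    x ⊕ r                     ∎
    where open ≡-Reasoning
  nth-σ (x ∷ w) {suc q} {r} (s≤s q<) r<m = begin
    nth (block x ++ σ m w) (m + q * m + r)                    ≡⟨ cong (nth (block x ++ σ m w)) (+-assoc m (q * m) r) ⟩
    nth (block x ++ σ m w) (m + (q * m + r))                  ≡⟨ cong (λ y → nth (block x ++ σ m w) (y + (q * m + r))) (length-block x) ⟨
    nth (block x ++ σ m w) (length (block x) + (q * m + r))   ≡⟨ nth-++ʳ (block x) (σ m w) (q * m + r) ⟩
    nth (σ m w) (q * m + r)                                   ≡⟨ nth-σ w q< r<m ⟩
    nth w q ⊕ r                                               ∎
    where open ≡-Reasoning

  σ^ : ℕ → List ℕ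
  σ^ j = iterate (σ m) j (0 ∷ [])

  σ^-extends : ∀ j → ∃ λ R → σ^ (suc j) ≡ σ^ j ++ R
  σ^-extends zero    = _ , refl
  σ^-extends (suc j) with σ^-extends j
  ... | R , eq = σ m R , trans (cong (σ m) eq) (concatMap-++ _ (σ^ j) R)

  σ^-stable : ∀ d j {n} → n < length (σ^ j) → n < length (σ^ (d + j)) × nth (σ^ (d + j)) n ≡ nth (σ^ j) n
  σ^-stable zero    j n< = n< , refl
  σ^-stable (suc d) j {n} n< with σ^-extends (d + j) | σ^-stable d j n<
  ... | R , eq | n<′ , nth≡ = subst (λ w → n < length w × nth w n ≡ nth (σ^ j) n) (sym eq)
    ( <-≤-trans n<′ (≤-trans (m≤m+n _ (length R)) (≤-reflexive (sym (length-++ (σ^ (d + j))))))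
    , trans (nth-++ˡ (σ^ (d + j)) R n<′) nth≡ )

  length-σ^ : ∀ j → j < length (σ^ j)
  length-σ^ zero    = z<s
  length-σ^ (suc j) = subst (suc j <_) (sym (length-σ (σ^ j))) (grow (length-σ^ j))
    where
    grow : ∀ {L} → j < L → suc j < L * m
    grow {suc L} j<L = ≤-<-trans j<L (m<m*n (suc L) m (s≤s (s≤s z≤n)))

  t-nth : ∀ j {n} → n < length (σ^ j) → t m n ≡ nth (σ^ j) n
  t-nth j {n} n< = begin
    nth (σ^ (suc n)) n      ≡⟨ proj₂ (σ^-stable j (suc n) (<-trans (n<1+n n) (length-σ^ (suc n)))) ⟨
    nth (σ^ (j + suc n)) n  ≡⟨ cong (λ d → nth (σ^ d) n) (+-comm j (suc n)) ⟩
    nth (σ^ (suc n + j)) n  ≡⟨ proj₂ (σ^-stable (suc n) j n<) ⟩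
    nth (σ^ j) n            ∎
    where open ≡-Reasoning

  t-block : ∀ q {r} → r < m → t m (q * m + r) ≡ t m q ⊕ r
  t-block q {r} r<m = trans (nth-σ (σ^ J) q< r<m) (cong (_⊕ r) (sym (t-nth J q<)))
    where
    J : ℕ
    J = q * m + r
    q< : q < length (σ^ J)
    q< = ≤-<-trans (≤-trans (m≤m*n q m) (m≤m+n (q * m) r)) (length-σ^ J)

  t-below : ∀ {x} → x < m → t m x ≡ x
  t-below {x} x<m = trans (t-block 0 x<m) (⊕-exact 0 x x<m)

  Adjacent : ℕ → ℕ → Set
  Adjacent x y = ∃ λ q → t m q ≡ x × t m (suc q) ≡ y

  adjacent-first : ∀ {x} → x < m → Adjacent x (x ⊕ 1)
  adjacent-first {x} x<m = x * m , first , second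
    where
    open ≡-Reasoning
    first : t m (x * m) ≡ x
    first = begin
      t m (x * m)       ≡⟨ cong (t m) (+-identityʳ (x * m)) ⟨
      t m (x * m + 0)   ≡⟨ t-block x z<s ⟩
      t m x ⊕ 0         ≡⟨ cong (_⊕ 0) (t-below x<m) ⟩
      x ⊕ 0             ≡⟨ ⊕-identityʳ x<m ⟩
      x                 ∎
    second : t m (suc (x * m)) ≡ x ⊕ 1
    second = begin
      t m (suc (x * m))  ≡⟨ cong (t m) (+-comm 1 (x * m)) ⟩
      t m (x * m + 1)    ≡⟨ t-block x (s≤s z<s) ⟩
      t m x ⊕ 1          ≡⟨ cong (_⊕ 1) (t-below x<m) ⟩
      x ⊕ 1              ∎

  adjacent-back : ∀ {x y} → x < m → Adjacent (x ⊕ 1) y → Adjacent x (y ⊕ 0)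
  adjacent-back {x} {y} x<m (Q , tQ , tQ+1) = Q * m + suc k , first , second
    where
    open ≡-Reasoning
    first : t m (Q * m + suc k) ≡ x
    first = begin
      t m (Q * m + suc k)  ≡⟨ t-block Q ≤-refl ⟩
      t m Q ⊕ suc k        ≡⟨ cong (_⊕ suc k) tQ ⟩
      x ⊕ 1 ⊕ suc k        ≡⟨ ⊕-assoc x 1 (suc k) ⟩
      (x + m) % m          ≡⟨ [m+n]%n≡m%n x m ⟩
      x % m                ≡⟨ m<n⇒m%n≡m x<m ⟩
      x                    ∎
    second : t m (suc (Q * m + suc k)) ≡ y ⊕ 0
    second = begin
      t m (suc (Q * m + suc k))  ≡⟨ cong (t m) (trans (sym (+-suc (Q * m) (suc k))) (trans (+-comm (Q * m) m) (sym (+-identityʳ _)))) ⟩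
      t m (suc Q * m + 0)        ≡⟨ t-block (suc Q) z<s ⟩
      t m (suc Q) ⊕ 0            ≡⟨ cong (_⊕ 0) tQ+1 ⟩
      y ⊕ 0                      ∎

  adjacent-gap : ∀ d {x} → x < m → Adjacent x (x ⊕ suc d)
  adjacent-gap zero    = adjacent-first
  adjacent-gap (suc d) {x} x<m with adjacent-back x<m (adjacent-gap d (⊕<m x 1))
  ... | q , tq , tq+1 = q , tq , trans tq+1 (begin
      x ⊕ 1 ⊕ suc d ⊕ 0          ≡⟨ cong (_⊕ 0) (⊕-assoc x 1 (suc d)) ⟩
      x ⊕ suc (suc d) ⊕ 0        ≡⟨ ⊕-assoc x (suc (suc d)) 0 ⟩
      x ⊕ (suc (suc d) + 0)      ≡⟨ cong (x ⊕_) (+-identityʳ _) ⟩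
      x ⊕ suc (suc d)            ∎)
    where open ≡-Reasoning

  adjacent : ∀ {x y} → x < m → y < m → Adjacent x y
  adjacent {x} {y} x<m y<m with adjacent-gap (y + suc k ∸ x) x<m
  ... | q , tq , tq+1 = q , tq , trans tq+1 wraps
    where
    open ≡-Reasoning
    wraps : x ⊕ suc (y + suc k ∸ x) ≡ y
    wraps = begin
      (x + suc (y + suc k ∸ x)) % m  ≡⟨ cong (_% m) (+-suc x _) ⟩
      suc (x + (y + suc k ∸ x)) % m  ≡⟨ cong (λ z → suc z % m) (m+[n∸m]≡n (≤-trans (≤-pred x<m) (m≤n+m (suc k) y))) ⟩
      suc (y + suc k) % m            ≡⟨ cong (_% m) (+-suc y (suc k)) ⟨
      (y + m) % m                    ≡⟨ [m+n]%n≡m%n y m ⟩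
      y % m                          ≡⟨ m<n⇒m%n≡m y<m ⟩
      y                              ∎

  run : ℕ → ℕ → List ℕ
  run i n = applyUpTo (λ j → t m (i + j)) n

  count-factor : ∀ a i n → count a (factor m i n) ≡ count a (run i n)
  count-factor a i n = cong (count a) (map-upTo _ n)

  run-in-block : ∀ q r n → r + n ≤ m → run (q * m + r) n ≡ applyUpTo ((t m q + r) ⊕_) n
  run-in-block q r n r+n≤m = applyUpTo-cong n λ {j} j<n → begin
    t m (q * m + r + j)    ≡⟨ cong (t m) (+-assoc (q * m) r j) ⟩
    t m (q * m + (r + j))  ≡⟨ t-block q (<-≤-trans (+-monoʳ-< r j<n) r+n≤m) ⟩
    t m q ⊕ (r + j)        ≡⟨ cong (_% m) (+-assoc (t m q) r j) ⟨
    (t m q + r) ⊕ j        ∎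
    where open ≡-Reasoning

  factor-in-block : ∀ q r n → r + n ≤ m → ∀ a → count a (factor m (q * m + r) n) ≡ arc (t m q + r) n a
  factor-in-block q r n r+n≤m a = trans (count-factor a (q * m + r) n) (cong (count a) (run-in-block q r n r+n≤m))

  factor-across-blocks : ∀ q r n₁ n₂ → r + n₁ ≡ m → n₂ ≤ m → ∀ a →
                         count a (factor m (q * m + r) (n₁ + n₂)) ≡ arc (t m q + r) n₁ a + arc (t m (suc q)) n₂ a
  factor-across-blocks q r n₁ n₂ r+n₁≡m n₂≤m a = begin
    count a (factor m (q * m + r) (n₁ + n₂))
      ≡⟨ count-factor a (q * m + r) (n₁ + n₂) ⟩
    count a (run (q * m + r) (n₁ + n₂))
      ≡⟨ cong (count a) (applyUpTo-+ _ n₁ n₂) ⟩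
    count a (run (q * m + r) n₁ ++ applyUpTo (λ j → t m (q * m + r + (n₁ + j))) n₂)
      ≡⟨ count-++ a (run (q * m + r) n₁) _ ⟩
    count a (run (q * m + r) n₁) + count a (applyUpTo (λ j → t m (q * m + r + (n₁ + j))) n₂)
      ≡⟨ cong₂ (λ u v → count a u + count a v) (run-in-block q r n₁ (≤-reflexive r+n₁≡m)) (applyUpTo-cong n₂ next-block) ⟩
    arc (t m q + r) n₁ a + arc (t m (suc q)) n₂ a
      ∎
    where
    open ≡-Reasoning
    regroup : ∀ a b c d → a + b + (c + d) ≡ a + (b + c) + d
    regroup = solve-∀
    next-block : ∀ {j} → j < n₂ → t m (q * m + r + (n₁ + j)) ≡ t m (suc q) ⊕ j
    next-block {j} j<n₂ = begin
      t m (q * m + r + (n₁ + j))   ≡⟨ cong (t m) (regroup (q * m) r n₁ j) ⟩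
      t m (q * m + (r + n₁) + j)   ≡⟨ cong (λ z → t m (q * m + z + j)) r+n₁≡m ⟩
      t m (q * m + m + j)          ≡⟨ cong (λ z → t m (z + j)) (+-comm (q * m) m) ⟩
      t m (suc q * m + j)          ≡⟨ t-block (suc q) (<-≤-trans j<n₂ n₂≤m) ⟩
      t m (suc q) ⊕ j              ∎

  factor-two-arcs-at : ∀ q r n → r < m → n ≤ m → ∃₂ λ x y → ∃₂ λ n₁ n₂ →
                       n₁ + n₂ ≡ n × (∀ a → count a (factor m (q * m + r) n) ≡ arc x n₁ a + arc y n₂ a)
  factor-two-arcs-at q r n r<m n≤m with r + n ≤? m
  ... | yes fits = t m q + r , 0 , n , 0 , +-identityʳ n , λ a → trans (factor-in-block q r n fits a) (sym (+-identityʳ _))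
  ... | no overflows = t m q + r , t m (suc q) , m ∸ r , n ∸ (m ∸ r) , m+[n∸m]≡n n₁≤n , λ a →
        trans (cong (λ w → count a (factor m (q * m + r) w)) (sym (m+[n∸m]≡n n₁≤n)))
              (factor-across-blocks q r (m ∸ r) (n ∸ (m ∸ r)) (m+[n∸m]≡n (<⇒≤ r<m)) (≤-trans (m∸n≤m n (m ∸ r)) n≤m) a)
    where
    n₁≤n : m ∸ r ≤ n
    n₁≤n = ≤-trans (∸-monoˡ-≤ r (<⇒≤ (≰⇒> overflows))) (≤-reflexive (m+n∸m≡n r n))

  factor-two-arcs : ∀ i {n} → n ≤ m → ∃₂ λ x y → ∃₂ λ n₁ n₂ →
                    n₁ + n₂ ≡ n × (∀ a → count a (factor m i n) ≡ arc x n₁ a + arc y n₂ a)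
  factor-two-arcs i {n} n≤m with factor-two-arcs-at (i / m) (i % m) n (m%n<n i m) n≤m
  ... | x , y , n₁ , n₂ , sum , count≡ = x , y , n₁ , n₂ , sum , λ a → trans (cong (λ j → count a (factor m j n)) i≡) (count≡ a)
    where
    i≡ : i ≡ i / m * m + i % m
    i≡ = trans (m≡m%n+[m/n]*n i m) (+-comm (i % m) _)

  realise-two-arcs : ∀ x y n₁ n₂ → n₁ ≤ m → n₂ ≤ m → ∃ λ i → ∀ a → count a (factor m i (n₁ + n₂)) ≡ arc x n₁ a + arc y n₂ a
  realise-two-arcs x y n₁ n₂ n₁≤m n₂≤m with adjacent (⊕<m x n₁) (m%n<n y m)
  ... | Q , tQ , tQ+1 = Q * m + (m ∸ n₁) , λ a →
        trans (factor-across-blocks Q (m ∸ n₁) n₁ n₂ (m∸n+n≡m n₁≤m) n₂≤m a)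
              (cong₂ _+_ (arc-cong (t m Q + (m ∸ n₁)) x n₁ a first-start) (arc-cong (t m (suc Q)) y n₂ a (trans (cong (_% m) tQ+1) (m%n%n≡m%n y m))))
    where
    first-start : (t m Q + (m ∸ n₁)) % m ≡ x % m
    first-start = trans (cong (λ z → (z + (m ∸ n₁)) % m) tQ) (⊕-complement x n₁≤m)

module Shapes (k ℓ : ℕ) (ℓ<m : ℓ < suc (suc k)) where
  open Sequence k public

  -- single s is the interval [s, s+ℓ).  nested i o s is [s, s+u), u = ℓ−w, together with the interval [s+o, s+o+w)
  -- inside it, w = i+1.  apart p q s is [s, s+α), α = ℓ−β, together with [s+D, s+D+β), β = p+1, D = distance p q,
  -- which leaves gaps of D−α and q+1 between them; s < p+q+2 means s+D < m and picks one of the two ways of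
  -- listing the two intervals.
  data Shape : Set where
    single        : (s : ℕ) → Shape
    apart nested  : (_ _ s : ℕ) → Shape

  distance : ℕ → ℕ → ℕ
  distance p q = m ∸ (p + q + 2)

  Canonical : Shape → Set
  Canonical (single s)     = s < m
  Canonical (apart p q s)  = suc p < ℓ × suc (ℓ + q) < m × s < p + q + 2
  Canonical (nested i o s) = o + suc (i + i) < ℓ × s < m

  profile : Shape → ℕ → ℕ
  profile (single s)     a = arc s ℓ a
  profile (apart p q s)  a = arc s (ℓ ∸ suc p) a + arc (s + distance p q) (suc p) a
  profile (nested i o s) a = arc s (ℓ ∸ suc i) a + arc (s + o) (suc i) a

  HasNormalForm : (ℕ → ℕ) → Set
  HasNormalForm f = Σ Shape λ c → Canonical c × (∀ a → f a ≡ profile c a)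

  HasNormalForm-resp : ∀ {f g} → (∀ a → f a ≡ g a) → HasNormalForm g → HasNormalForm f
  HasNormalForm-resp f≗g (c , canon , g≗c) = c , canon , λ a → trans (f≗g a) (g≗c a)

  apart-normal : ∀ s α D p → s + D < m → 1 ≤ α → α + suc p ≡ ℓ → α < D → D + suc p < m →
                 HasNormalForm (λ a → arc s α a + arc (s + D) (suc p) a)
  apart-normal s α D p s+D<m 1≤α sum α<D D+β<m with apart-parameters m ℓ s α D p s+D<m 1≤α sum α<D D+β<m
  ... | β<ℓ , ℓ+q<m , s< , α≡ , D≡ = apart p (m ∸ suc (D + suc p)) s , (β<ℓ , ℓ+q<m , s<) ,
        λ a → cong₂ _+_ (cong (λ n → arc s n a) (sym α≡)) (cong (λ z → arc (s + z) (suc p) a) (sym D≡))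

  overlapping-normal : ∀ x k′ d j → x < m → d < k′ → 1 ≤ j → k′ + j ≡ ℓ →
                       HasNormalForm (λ a → arc x k′ a + arc (x + d) j a)
  overlapping-normal x k′ d (suc i) x<m d<k′ _ sum with d + suc i ≤? k′
  ... | yes inside with nested-parameters-inside ℓ d k′ i inside sum
  ...   | fits , u≡ = nested i d x , (fits , x<m) , λ a → cong (λ n → arc x n a + arc (x + d) (suc i) a) (sym u≡)
  overlapping-normal x k′ d (suc i′) x<m d<k′ _ sum | no overhangs with m≤n⇒∃[o]m+o≡n d<k′
  ... | i , refl with nested-parameters-overhang ℓ d i (suc i′) inner<j (trans (cong (_+ suc i′) (+-suc d i)) sum)
    where
    inner<j : suc i < suc i′
    inner<j = +-cancelˡ-< d (suc i) (suc i′) (subst (_< d + suc i′) (sym (+-suc d i)) (≰⇒> overhangs))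
  ... | fits , u≡ = nested i d x , (fits , x<m) , λ a → begin
      arc x (suc d + i) a + arc (x + d) (suc i′) a                 ≡⟨ cong (λ n → arc x n a + arc (x + d) (suc i′) a) (+-suc d i) ⟨
      arc x (d + suc i) a + arc (x + d) (suc i′) a                 ≡⟨ cong (_+ arc (x + d) (suc i′) a) (arc-+ x d (suc i) a) ⟩
      arc x d a + arc (x + d) (suc i) a + arc (x + d) (suc i′) a   ≡⟨ swap (arc x d a) _ _ ⟩
      arc x d a + arc (x + d) (suc i′) a + arc (x + d) (suc i) a   ≡⟨ cong (_+ arc (x + d) (suc i) a) (arc-+ x d (suc i′) a) ⟨
      arc x (d + suc i′) a + arc (x + d) (suc i) a                 ≡⟨ cong (λ n → arc x n a + arc (x + d) (suc i) a) u≡ ⟨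
      arc x (ℓ ∸ suc i) a + arc (x + d) (suc i) a                  ∎
    where
    open ≡-Reasoning
    swap : ∀ a b c → a + b + c ≡ a + c + b
    swap = solve-∀

  apart-normal-wrapped : ∀ x d p′ p → x < m → d < m → suc p′ + suc p ≡ ℓ → suc p′ < d → d + suc p < m → m ≤ x + d →
                         HasNormalForm (λ a → arc x (suc p′) a + arc (x + d) (suc p) a)
  apart-normal-wrapped x d p′ p x<m d<m sum k′<d d+j<m m≤x+d = HasNormalForm-resp swapped
    (apart-normal y (suc p) (m ∸ d) p′ (subst (_< m) (sym y+d′≡x) x<m) (s≤s z≤n) (trans (+-comm (suc p) (suc p′)) sum)
                  (m+n≤o⇒m≤o∸n (suc (suc p)) (subst (_≤ m) (cong suc (+-comm d (suc p))) d+j<m))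
                  (∸-+-< m d (suc p′) k′<d (<⇒≤ d<m)))
    where
    y : ℕ
    y = x + d ∸ m
    y+d′≡x : y + (m ∸ d) ≡ x
    y+d′≡x = ∸-wrap m x d m≤x+d (<⇒≤ d<m)
    swapped : ∀ a → arc x (suc p′) a + arc (x + d) (suc p) a ≡ arc y (suc p) a + arc (y + (m ∸ d)) (suc p′) a
    swapped a = trans (+-comm (arc x (suc p′) a) _)
      (cong₂ _+_ (arc-cong (x + d) y (suc p) a (sym (m≤n⇒[n∸m]%m≡n%m m≤x+d)))
                 (cong (λ z → arc z (suc p′) a) (sym y+d′≡x)))

  disjoint-normal : ∀ x d p′ p → x < m → d < m → suc p′ + suc p ≡ ℓ → suc p′ < d →
                    HasNormalForm (λ a → arc x (suc p′) a + arc (x + d) (suc p) a)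
  disjoint-normal x d p′ p x<m d<m sum k′<d with <-cmp (d + suc p) m
  ... | tri< d+j<m _ _ with x + d <? m
  ...   | yes x+d<m = apart-normal x (suc p′) d p x+d<m (s≤s z≤n) sum k′<d d+j<m
  ...   | no x+d≮m = apart-normal-wrapped x d p′ p x<m d<m sum k′<d d+j<m (≮⇒≥ x+d≮m)
  disjoint-normal x d p′ p x<m d<m sum k′<d | tri≈ _ d+j≡m _ =
    HasNormalForm-resp joined (single (x ⊕ d) , ⊕<m x d , λ a → refl)
    where
    open ≡-Reasoning
    wraps : (x + d + suc p) % m ≡ x % m
    wraps = trans (cong (_% m) (trans (+-assoc x d (suc p)) (cong (x +_) d+j≡m))) ([m+n]%n≡m%n x m)
    joined : ∀ a → arc x (suc p′) a + arc (x + d) (suc p) a ≡ arc (x ⊕ d) ℓ a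
    joined a = begin
      arc x (suc p′) a + arc (x + d) (suc p) a   ≡⟨ +-comm (arc x (suc p′) a) _ ⟩
      arc (x + d) (suc p) a + arc x (suc p′) a   ≡⟨ arc-join (x + d) (suc p) x (suc p′) a wraps ⟩
      arc (x + d) (suc p + suc p′) a             ≡⟨ cong (λ n → arc (x + d) n a) (trans (+-comm (suc p) (suc p′)) sum) ⟩
      arc (x + d) ℓ a                            ≡⟨ arc-cong (x + d) (x ⊕ d) ℓ a (sym (m%n%n≡m%n (x + d) m)) ⟩
      arc (x ⊕ d) ℓ a                            ∎
  disjoint-normal x d p′ p x<m d<m sum k′<d | tri> _ _ m<d+j =
    HasNormalForm-resp swapped
      (overlapping-normal (x ⊕ d) (suc p) (m ∸ d) (suc p′) (⊕<m x d) (∸-<-overhang m d (suc p) m<d+j (<⇒≤ d<m)) (s≤s z≤n)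
                          (trans (+-comm (suc p) (suc p′)) sum))
    where
    swapped : ∀ a → arc x (suc p′) a + arc (x + d) (suc p) a ≡ arc (x ⊕ d) (suc p) a + arc (x ⊕ d + (m ∸ d)) (suc p′) a
    swapped a = trans (+-comm (arc x (suc p′) a) _)
      (cong₂ _+_ (arc-cong (x + d) (x ⊕ d) (suc p) a (sym (m%n%n≡m%n (x + d) m)))
                 (arc-cong x (x ⊕ d + (m ∸ d)) (suc p′) a (sym (⊕-complement x (<⇒≤ d<m)))))

  normal-form-offset : ∀ x d k′ j → x < m → d < m → 1 ≤ k′ → 1 ≤ j → k′ + j ≡ ℓ →
                       HasNormalForm (λ a → arc x k′ a + arc (x + d) j a)
  normal-form-offset x d k′ j x<m d<m _ j≥1 sum with <-cmp d k′
  ... | tri< d<k′ _ _ = overlapping-normal x k′ d j x<m d<k′ j≥1 sum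
  ... | tri≈ _ refl _ = single x , x<m , λ a → trans (sym (arc-+ x d j a)) (cong (λ n → arc x n a) sum)
  normal-form-offset x d (suc p′) (suc p) x<m d<m _ _ sum | tri> _ _ k′<d = disjoint-normal x d p′ p x<m d<m sum k′<d

  normal-form-two-arcs : ∀ x y n₁ n₂ → 1 ≤ n₁ → 1 ≤ n₂ → n₁ + n₂ ≡ ℓ →
                         HasNormalForm (λ a → arc x n₁ a + arc y n₂ a)
  normal-form-two-arcs x y n₁ n₂ n₁≥1 n₂≥1 sum =
    HasNormalForm-resp reduced
      (normal-form-offset (x % m) (offset x y) n₁ n₂ (m%n<n x m) (offset<m x y) n₁≥1 n₂≥1 sum)
    where
    reduced : ∀ a → arc x n₁ a + arc y n₂ a ≡ arc (x % m) n₁ a + arc (x % m + offset x y) n₂ a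
    reduced a = cong₂ _+_ (arc-cong x (x % m) n₁ a (sym (m%n%n≡m%n x m)))
                          (arc-cong y (x % m + offset x y) n₂ a (sym (⊕-offset x y)))

  normal-form : ∀ x y n₁ n₂ → n₁ + n₂ ≡ ℓ → HasNormalForm (λ a → arc x n₁ a + arc y n₂ a)
  normal-form x y zero n₂ refl = single (y % m) , m%n<n y m , λ a → arc-cong y (y % m) ℓ a (sym (m%n%n≡m%n y m))
  normal-form x y (suc n₁) zero sum = single (x % m) , m%n<n x m , λ a →
    trans (+-identityʳ _) (trans (cong (λ n → arc x n a) (trans (sym (+-identityʳ _)) sum)) (arc-cong x (x % m) ℓ a (sym (m%n%n≡m%n x m))))
  normal-form x y (suc n₁) (suc n₂) sum = normal-form-two-arcs x y (suc n₁) (suc n₂) (s≤s z≤n) (s≤s z≤n) sum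

  factor-normal : ∀ i → HasNormalForm (λ a → count a (factor m i ℓ))
  factor-normal i with factor-two-arcs i (<⇒≤ ℓ<m)
  ... | x , y , n₁ , n₂ , sum , count≡ = HasNormalForm-resp count≡ (normal-form x y n₁ n₂ sum)

module Boundaries (k ℓ : ℕ) (1≤ℓ : 1 ≤ ℓ) (ℓ<m : ℓ < suc (suc k)) where
  open Shapes k ℓ ℓ<m public

  starts ends : Shape → ℕ → ℕ
  starts (single s)     a = δ a (s ⊕ 0)
  starts (apart p q s)  a = δ a (s ⊕ 0) + δ a (s ⊕ distance p q)
  starts (nested i o s) a = δ a (s ⊕ 0) + δ a (s ⊕ o)
  ends (single s)     a = δ a (s ⊕ ℓ)
  ends (apart p q s)  a = δ a (s ⊕ (ℓ ∸ suc p)) + δ a (s ⊕ (distance p q + suc p))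
  ends (nested i o s) a = δ a (s ⊕ (ℓ ∸ suc i)) + δ a (s ⊕ (o + suc i))

  two-arcs-boundary : ∀ s n₁ o n₂ {a} → a < m →
    arc s n₁ a + arc (s + o) n₂ a + (δ a (s ⊕ n₁) + δ a (s ⊕ (o + n₂)))
      ≡ δ a (s ⊕ 0) + δ a (s ⊕ o) + (arc s n₁ (prev a) + arc (s + o) n₂ (prev a))
  two-arcs-boundary s n₁ o n₂ {a} a<m = begin
    X + Y + (δ a (s ⊕ n₁) + δ a (s ⊕ (o + n₂)))          ≡⟨ interchange X Y _ _ ⟩
    (X + δ a (s ⊕ n₁)) + (Y + δ a (s ⊕ (o + n₂)))        ≡⟨ cong₂ _+_ (arc-boundary s n₁ a<m) second ⟩
    (δ a (s ⊕ 0) + X′) + (δ a (s ⊕ o) + Y′)              ≡⟨ interchange (δ a (s ⊕ 0)) X′ _ _ ⟩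
    δ a (s ⊕ 0) + δ a (s ⊕ o) + (X′ + Y′)                ∎
    where
    open ≡-Reasoning
    X Y X′ Y′ : ℕ
    X = arc s n₁ a
    Y = arc (s + o) n₂ a
    X′ = arc s n₁ (prev a)
    Y′ = arc (s + o) n₂ (prev a)
    interchange : ∀ w x y z → w + x + (y + z) ≡ w + y + (x + z)
    interchange = solve-∀
    second : Y + δ a (s ⊕ (o + n₂)) ≡ δ a (s ⊕ o) + Y′
    second = begin
      Y + δ a (s ⊕ (o + n₂))        ≡⟨ cong (λ z → Y + δ a (z % m)) (+-assoc s o n₂) ⟨
      Y + δ a ((s + o) ⊕ n₂)        ≡⟨ arc-boundary (s + o) n₂ a<m ⟩
      δ a ((s + o) ⊕ 0) + Y′        ≡⟨ cong (λ z → δ a (z % m) + Y′) (+-identityʳ (s + o)) ⟩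
      δ a (s ⊕ o) + Y′              ∎

  profile-boundary : ∀ c {a} → a < m → profile c a + ends c a ≡ starts c a + profile c (prev a)
  profile-boundary (single s)     = arc-boundary s ℓ
  profile-boundary (apart p q s)  = two-arcs-boundary s (ℓ ∸ suc p) (distance p q) (suc p)
  profile-boundary (nested i o s) = two-arcs-boundary s (ℓ ∸ suc i) o (suc i)

  record ApartBounds (p q s : ℕ) : Set where
    field
      1≤α   : 1 ≤ ℓ ∸ suc p
      α<D   : ℓ ∸ suc p < distance p q
      D+β<m : distance p q + suc p < m
      s+D<m : s + distance p q < m
      β<ℓ   : suc p < ℓ
    D<m : distance p q < m
    D<m = ≤-<-trans (m≤m+n _ (suc p)) D+β<m
    α<m : ℓ ∸ suc p < m
    α<m = <-trans α<D D<m
    s<m : s < m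
    s<m = ≤-<-trans (m≤m+n s _) s+D<m
    p+q+2≤m : p + q + 2 ≤ m
    p+q+2≤m = <⇒≤ (m∸n≢0⇒n<m (λ D≡0 → n≮0 (subst (ℓ ∸ suc p <_) D≡0 α<D)))

  apart-bounds : ∀ p q s → Canonical (apart p q s) → ApartBounds p q s
  apart-bounds p q s (β<ℓ , ℓ+q<m , s<) with apart-geometry m ℓ p q s β<ℓ ℓ+q<m s<
  ... | 1≤α , α<D , D+β<m , s+D<m = record { 1≤α = 1≤α ; α<D = α<D ; D+β<m = D+β<m ; s+D<m = s+D<m ; β<ℓ = β<ℓ }

  record NestedBounds (i o s : ℕ) : Set where
    field
      o+w≤u : o + suc i ≤ ℓ ∸ suc i
      u<m   : ℓ ∸ suc i < m
      u+w≡ℓ : ℓ ∸ suc i + suc i ≡ ℓ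
      s<m   : s < m
    o+w<m : o + suc i < m
    o+w<m = ≤-<-trans o+w≤u u<m
    o<m : o < m
    o<m = ≤-<-trans (m≤m+n o (suc i)) o+w<m
    o<u : o < ℓ ∸ suc i
    o<u = <-≤-trans (m<m+n o z<s) o+w≤u
    w≤ℓ : suc i ≤ ℓ
    w≤ℓ = subst (suc i ≤_) u+w≡ℓ (m≤n+m (suc i) _)

  nested-bounds : ∀ i o s → Canonical (nested i o s) → NestedBounds i o s
  nested-bounds i o s (fits , s<m) with nested-geometry m ℓ i o fits ℓ<m
  ... | o+w≤u , u<m , u+w≡ℓ = record { o+w≤u = o+w≤u ; u<m = u<m ; u+w≡ℓ = u+w≡ℓ ; s<m = s<m }

  boundaries-disjoint : ∀ c → Canonical c → ∀ a → starts c a ≡ 0 ⊎ ends c a ≡ 0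
  boundaries-disjoint (single s) _ = δ-disjoint (⊕-≢ s z<s ℓ<m (<⇒≢ 1≤ℓ))
  boundaries-disjoint (apart p q s) canon = δ₂-disjoint
      (⊕-≢ s z<s α<m (<⇒≢ 1≤α))
      (⊕-≢ s z<s D+β<m (λ 0≡ → m+1+n≢0 _ (sym 0≡)))
      (⊕-≢ s D<m α<m (>⇒≢ α<D))
      (⊕-≢ s D<m D+β<m (λ D≡ → m+1+n≢m _ (sym D≡)))
    where open ApartBounds (apart-bounds p q s canon)
  boundaries-disjoint (nested i o s) canon = δ₂-disjoint
      (⊕-≢ s z<s u<m (<⇒≢ (≤-<-trans z≤n o<u)))
      (⊕-≢ s z<s o+w<m (λ 0≡ → m+1+n≢0 o (sym 0≡)))
      (⊕-≢ s o<m u<m (<⇒≢ o<u))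
      (⊕-≢ s o<m o+w<m (λ o≡ → m+1+n≢m o (sym o≡)))
    where open NestedBounds (nested-bounds i o s canon)

  SameProfile SameStarts SameEnds : Shape → Shape → Set
  SameProfile c c′ = ∀ a → a < m → profile c a ≡ profile c′ a
  SameStarts c c′ = ∀ a → a < m → starts c a ≡ starts c′ a
  SameEnds c c′ = ∀ a → a < m → ends c a ≡ ends c′ a

  boundaries-determined : ∀ c c′ → Canonical c → Canonical c′ → SameProfile c c′ → SameStarts c c′ × SameEnds c c′
  boundaries-determined c c′ canon canon′ same = (λ a a<m → proj₁ (both a a<m)) , (λ a a<m → proj₂ (both a a<m))
    where
    both : ∀ a → a < m → starts c a ≡ starts c′ a × ends c a ≡ ends c′ a
    both a a<m = disjoint-cancel
      (cross-cancel (profile c a) (profile c (prev a)) (profile-boundary c a<m)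
                    (trans (cong (_+ ends c′ a) (same a a<m))
                           (trans (profile-boundary c′ a<m) (cong (starts c′ a +_) (sym (same (prev a) (prev<m a)))))))
      (boundaries-disjoint c canon a) (boundaries-disjoint c′ canon′ a)

  single-profile-injective : ∀ {s s′} → Canonical (single s) → Canonical (single s′) →
                             SameProfile (single s) (single s′) → single s ≡ single s′
  single-profile-injective {s} {s′} s<m s′<m same = cong single (begin
    s         ≡⟨ ⊕-identityʳ s<m ⟨
    s ⊕ 0     ≡⟨ δ-injective (⊕<m s 0) (proj₁ (boundaries-determined (single s) (single s′) s<m s′<m same)) ⟩
    s′ ⊕ 0    ≡⟨ ⊕-identityʳ s′<m ⟩
    s′        ∎)
    where open ≡-Reasoning

  single≉apart : ∀ {s p q s′} → Canonical (single s) → Canonical (apart p q s′) → ¬ SameProfile (single s) (apart p q s′)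
  single≉apart {s} {p} {q} {s′} canon canon′ same =
    δ≢δ+δ (⊕<m s′ 0) (⊕<m s′ (distance p q)) (proj₁ (boundaries-determined (single s) (apart p q s′) canon canon′ same))

  single≉nested : ∀ {s i o s′} → Canonical (single s) → Canonical (nested i o s′) → ¬ SameProfile (single s) (nested i o s′)
  single≉nested {s} {i} {o} {s′} canon canon′ same =
    δ≢δ+δ (⊕<m s′ 0) (⊕<m s′ o) (proj₁ (boundaries-determined (single s) (nested i o s′) canon canon′ same))

  apart-profile-injective : ∀ {p q s p′ q′ s′} → Canonical (apart p q s) → Canonical (apart p′ q′ s′) →
                            SameProfile (apart p q s) (apart p′ q′ s′) → apart p q s ≡ apart p′ q′ s′
  apart-profile-injective {p} {q} {s} {p′} {q′} {s′} canon canon′ same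
    with boundaries-determined (apart p q s) (apart p′ q′ s′) canon canon′ same
  ... | starts≡ , ends≡ = same-lengths (same-starts (δ+δ-injective (⊕<m s 0) (⊕<m s D) starts≡))
    where
    open ApartBounds (apart-bounds p q s canon)
    module B′ = ApartBounds (apart-bounds p′ q′ s′ canon′)
    D D′ α : ℕ
    D = distance p q
    D′ = distance p′ q′
    α = ℓ ∸ suc p
    same-starts : (s ⊕ 0 ≡ s′ ⊕ 0 × s ⊕ D ≡ s′ ⊕ D′) ⊎ (s ⊕ 0 ≡ s′ ⊕ D′ × s ⊕ D ≡ s′ ⊕ 0) → s ≡ s′ × D ≡ D′
    same-starts (inj₁ (e₁ , e₂)) = s≡s′ , +-cancelˡ-≡ s D D′
      (trans (sym (⊕-exact s D s+D<m)) (trans e₂ (trans (⊕-exact s′ D′ B′.s+D<m) (cong (_+ D′) (sym s≡s′)))))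
      where
      s≡s′ : s ≡ s′
      s≡s′ = trans (sym (⊕-identityʳ s<m)) (trans e₁ (⊕-identityʳ B′.s<m))
    same-starts (inj₂ (e₁ , e₂)) = contradiction (m+n≡0⇒n≡0 D′ (+-cancelˡ-≡ s′ (D′ + D) 0 loop)) (≢-sym (<⇒≢ (≤-<-trans z≤n α<D)))
      where
      open ≡-Reasoning
      loop : s′ + (D′ + D) ≡ s′ + 0
      loop = begin
        s′ + (D′ + D)   ≡⟨ +-assoc s′ D′ D ⟨
        s′ + D′ + D     ≡⟨ cong (_+ D) (trans (sym (⊕-exact s′ D′ B′.s+D<m)) (trans (sym e₁) (⊕-identityʳ s<m))) ⟩
        s + D           ≡⟨ trans (sym (⊕-exact s D s+D<m)) (trans e₂ (⊕-identityʳ B′.s<m)) ⟩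
        s′              ≡⟨ +-identityʳ s′ ⟨
        s′ + 0          ∎
    same-lengths : s ≡ s′ × D ≡ D′ → apart p q s ≡ apart p′ q′ s′
    same-lengths (refl , D≡D′) with δ+δ-injective (⊕<m s α) (⊕<m s (D + suc p)) ends≡
    ... | inj₂ (e , _) = contradiction (⊕-cancelˡ s α<m B′.D+β<m e)
                           (<⇒≢ (<-≤-trans α<D (subst (_≤ D′ + suc p′) (sym D≡D′) (m≤m+n D′ (suc p′)))))
    ... | inj₁ (e , _) = cong₂ (λ x y → apart x y s) p≡p′
          (+-cancelˡ-≡ p q q′ (+-cancelʳ-≡ 2 (p + q) (p + q′)
            (trans (∸-cancelˡ-≡ p+q+2≤m B′.p+q+2≤m D≡D′) (cong (λ z → z + q′ + 2) (sym p≡p′)))))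
      where
      p≡p′ : p ≡ p′
      p≡p′ = suc-injective (∸-cancelˡ-≡ (<⇒≤ β<ℓ) (<⇒≤ B′.β<ℓ) (⊕-cancelˡ s α<m B′.α<m e))

  apart≉nested-crosswise : ∀ {p q s i o s′} → Canonical (apart p q s) → Canonical (nested i o s′) →
                           SameEnds (apart p q s) (nested i o s′) → s ⊕ 0 ≡ s′ ⊕ o → s ⊕ distance p q ≡ s′ ⊕ 0 → ⊥
  apart≉nested-crosswise {p} {q} {s} {i} {o} {s′} canon canon′ ends≡ e₁ e₂ =
    crossed (δ+δ-injective (⊕<m s′ (o + α)) (⊕<m s′ (suc p)) ends≡′)
    where
    open ApartBounds (apart-bounds p q s canon)
    module N = NestedBounds (nested-bounds i o s′ canon′)
    D α u : ℕ
    D = distance p q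
    α = ℓ ∸ suc p
    u = ℓ ∸ suc i
    s≡ : s ≡ s′ ⊕ o
    s≡ = trans (sym (⊕-identityʳ s<m)) e₁
    o+D≡m : o + D ≡ m
    o+D≡m = wraps-around s′ N.s<m N.o<m (≤-<-trans z≤n α<D) D<m
              (trans (cong (_+ D) (sym s≡)) (trans (sym (⊕-exact s D s+D<m)) (trans e₂ (⊕-identityʳ N.s<m))))
    first-end : s ⊕ α ≡ s′ ⊕ (o + α)
    first-end = trans (cong (_⊕ α) s≡) (⊕-assoc s′ o α)
    second-end : s ⊕ (D + suc p) ≡ s′ ⊕ suc p
    second-end = trans (cong (_⊕ (D + suc p)) s≡) (trans (⊕-assoc s′ o (D + suc p))
                   (trans (cong (s′ ⊕_) (trans (sym (+-assoc o D (suc p))) (cong (_+ suc p) o+D≡m))) (⊕-wrap s′ (suc p))))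
    ends≡′ : ∀ a → a < m → δ a (s′ ⊕ (o + α)) + δ a (s′ ⊕ suc p) ≡ δ a (s′ ⊕ u) + δ a (s′ ⊕ (o + suc i))
    ends≡′ a a<m = trans (cong₂ (λ x y → δ a x + δ a y) (sym first-end) (sym second-end)) (ends≡ a a<m)
    β<o : suc p < o
    β<o = +-cancelˡ-< D (suc p) o (subst (D + suc p <_) (trans (sym o+D≡m) (+-comm o D)) D+β<m)
    β<m : suc p < m
    β<m = ≤-<-trans (m≤n+m (suc p) D) D+β<m
    crossed : (s′ ⊕ (o + α) ≡ s′ ⊕ u × s′ ⊕ suc p ≡ s′ ⊕ (o + suc i))
            ⊎ (s′ ⊕ (o + α) ≡ s′ ⊕ (o + suc i) × s′ ⊕ suc p ≡ s′ ⊕ u) → ⊥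
    crossed (inj₁ (_ , f)) = <-irrefl refl (<-≤-trans β<o (subst (o ≤_) (sym (⊕-cancelˡ s′ β<m N.o+w<m f)) (m≤m+n o (suc i))))
    crossed (inj₂ (_ , f)) = <-irrefl refl (<-trans β<o (subst (o <_) (sym (⊕-cancelˡ s′ β<m N.u<m f)) N.o<u))

  apart≉nested : ∀ {p q s i o s′} → Canonical (apart p q s) → Canonical (nested i o s′) → ¬ SameProfile (apart p q s) (nested i o s′)
  apart≉nested {p} {q} {s} {i} {o} {s′} canon canon′ same
    with boundaries-determined (apart p q s) (nested i o s′) canon canon′ same
  ... | starts≡ , ends≡ with δ+δ-injective (⊕<m s 0) (⊕<m s (distance p q)) starts≡
  ...   | inj₂ (e₁ , e₂) = apart≉nested-crosswise canon canon′ ends≡ e₁ e₂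
  ...   | inj₁ (e₁ , e₂) = same-anchor (trans (sym (⊕-identityʳ s<m)) (trans e₁ (⊕-identityʳ N.s<m))) e₂
    where
    open ApartBounds (apart-bounds p q s canon)
    module N = NestedBounds (nested-bounds i o s′ canon′)
    α : ℕ
    α = ℓ ∸ suc p
    same-anchor : s ≡ s′ → s ⊕ distance p q ≡ s′ ⊕ o → ⊥
    same-anchor refl e with ⊕-cancelˡ s D<m N.o<m e
    ... | refl with δ+δ-injective (⊕<m s α) (⊕<m s (distance p q + suc p)) ends≡
    ... | inj₁ (f , _) = <-irrefl refl (<-trans α<D (subst (o <_) (sym (⊕-cancelˡ s α<m N.u<m f)) N.o<u))
    ... | inj₂ (f , _) = <-irrefl refl (<-≤-trans α<D (subst (o ≤_) (sym (⊕-cancelˡ s α<m N.o+w<m f)) (m≤m+n o (suc i))))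

  nested-crosswise : ∀ {i o s i′ o′ s′} → Canonical (nested i o s) → Canonical (nested i′ o′ s′) →
                     SameEnds (nested i o s) (nested i′ o′ s′) → s ≡ s′ ⊕ o′ → o + o′ ≡ m → ⊥
  nested-crosswise {i} {o} {s} {i′} {o′} {s′} canon canon′ ends≡ s≡ o+o′≡m =
    crossed (δ+δ-injective (⊕<m s u) (⊕<m s (o + suc i)) ends≡′)
    where
    module N = NestedBounds (nested-bounds i o s canon)
    module N′ = NestedBounds (nested-bounds i′ o′ s′ canon′)
    u u′ : ℕ
    u = ℓ ∸ suc i
    u′ = ℓ ∸ suc i′
    o′≤u′ : o′ ≤ u′
    o′≤u′ = ≤-trans (m≤m+n o′ (suc i′)) N′.o+w≤u
    first-end : s′ ⊕ u′ ≡ s ⊕ (u′ ∸ o′)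
    first-end = sym (trans (cong (_⊕ (u′ ∸ o′)) s≡) (trans (⊕-assoc s′ o′ (u′ ∸ o′)) (cong (s′ ⊕_) (m+[n∸m]≡n o′≤u′))))
    second-end : s′ ⊕ (o′ + suc i′) ≡ s ⊕ suc i′
    second-end = sym (trans (cong (_⊕ suc i′) s≡) (⊕-assoc s′ o′ (suc i′)))
    ends≡′ : ∀ a → a < m → δ a (s ⊕ u) + δ a (s ⊕ (o + suc i)) ≡ δ a (s ⊕ (u′ ∸ o′)) + δ a (s ⊕ suc i′)
    ends≡′ a a<m = trans (ends≡ a a<m) (cong₂ (λ x y → δ a x + δ a y) first-end second-end)
    u′∸o′<m : u′ ∸ o′ < m
    u′∸o′<m = ≤-<-trans (m∸n≤m u′ o′) N′.u<m
    w′<m : suc i′ < m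
    w′<m = ≤-<-trans (m≤n+m (suc i′) o′) N′.o+w<m
    crossed : (s ⊕ u ≡ s ⊕ (u′ ∸ o′) × s ⊕ (o + suc i) ≡ s ⊕ suc i′)
            ⊎ (s ⊕ u ≡ s ⊕ suc i′ × s ⊕ (o + suc i) ≡ s ⊕ (u′ ∸ o′)) → ⊥
    crossed (inj₁ (f₁ , f₂)) = contradiction
      (trans (sym o+o′≡m) (shifted-lengths (trans N.u+w≡ℓ (sym N′.u+w≡ℓ)) o′≤u′
                             (⊕-cancelˡ s N.u<m u′∸o′<m f₁) (⊕-cancelˡ s N.o+w<m w′<m f₂)))
      (λ ())
    crossed (inj₂ (_ , f₂)) = <-irrefl o+o′≡m (<-trans (∸-fits⇒< o′≤u′ (⊕-cancelˡ s N.o+w<m u′∸o′<m f₂)) N′.u<m)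

  nested-same-anchor : ∀ {i i′ o s} → Canonical (nested i o s) → Canonical (nested i′ o s) →
                       SameEnds (nested i o s) (nested i′ o s) → i ≡ i′
  nested-same-anchor {i} {i′} {o} {s} canon canon′ ends≡ with δ+δ-injective (⊕<m s (ℓ ∸ suc i)) (⊕<m s (o + suc i)) ends≡
  ... | inj₁ (e , _) = suc-injective (∸-cancelˡ-≡ N.w≤ℓ N′.w≤ℓ (⊕-cancelˡ s N.u<m N′.u<m e))
    where
    module N = NestedBounds (nested-bounds i o s canon)
    module N′ = NestedBounds (nested-bounds i′ o s canon′)
  ... | inj₂ (e₁ , e₂) = suc-injective (≤-antisym
        (+-cancelˡ-≤ o (suc i) (suc i′) (≤-trans N.o+w≤u (≤-reflexive (⊕-cancelˡ s N.u<m N′.o+w<m e₁))))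
        (+-cancelˡ-≤ o (suc i′) (suc i) (≤-trans N′.o+w≤u (≤-reflexive (sym (⊕-cancelˡ s N.o+w<m N′.u<m e₂))))))
    where
    module N = NestedBounds (nested-bounds i o s canon)
    module N′ = NestedBounds (nested-bounds i′ o s canon′)

  nested-profile-injective : ∀ {i o s i′ o′ s′} → Canonical (nested i o s) → Canonical (nested i′ o′ s′) →
                             SameProfile (nested i o s) (nested i′ o′ s′) → nested i o s ≡ nested i′ o′ s′
  nested-profile-injective {i} {o} {s} {i′} {o′} {s′} canon canon′ same
    with boundaries-determined (nested i o s) (nested i′ o′ s′) canon canon′ same
  ... | starts≡ , ends≡ = anchors (δ+δ-injective (⊕<m s 0) (⊕<m s o) starts≡)
    where
    module N = NestedBounds (nested-bounds i o s canon)
    module N′ = NestedBounds (nested-bounds i′ o′ s′ canon′)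
    anchored : s ≡ s′ → o ≡ o′ → nested i o s ≡ nested i′ o′ s′
    anchored refl refl = cong (λ z → nested z o s) (nested-same-anchor canon canon′ ends≡)
    anchors : (s ⊕ 0 ≡ s′ ⊕ 0 × s ⊕ o ≡ s′ ⊕ o′) ⊎ (s ⊕ 0 ≡ s′ ⊕ o′ × s ⊕ o ≡ s′ ⊕ 0) → nested i o s ≡ nested i′ o′ s′
    anchors (inj₁ (e₁ , e₂)) = anchored s≡s′ (⊕-cancelˡ s N.o<m N′.o<m (trans e₂ (cong (_⊕ o′) (sym s≡s′))))
      where
      s≡s′ : s ≡ s′
      s≡s′ = trans (sym (⊕-identityʳ N.s<m)) (trans e₁ (⊕-identityʳ N′.s<m))
    anchors (inj₂ (e₁ , e₂)) with ⊕-period s N.o<m N′.o<m (trans (sym (⊕-assoc s o o′)) (trans (cong (_⊕ o′) s≡) (sym e₁)))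
      where
      s≡ : s ⊕ o ≡ s′
      s≡ = trans e₂ (⊕-identityʳ N′.s<m)
    ... | inj₂ o+o′≡m = ⊥-elim (nested-crosswise canon canon′ ends≡ (trans (sym (⊕-identityʳ N.s<m)) e₁) o+o′≡m)
    ... | inj₁ o+o′≡0 = anchored (trans (sym (⊕-identityʳ N.s<m)) (trans (cong (s ⊕_) (sym o≡0)) (trans e₂ (⊕-identityʳ N′.s<m))))
                                 (trans o≡0 (sym (m+n≡0⇒n≡0 o o+o′≡0)))
      where
      o≡0 : o ≡ 0
      o≡0 = m+n≡0⇒m≡0 o o+o′≡0

  profile-injective : ∀ c c′ → Canonical c → Canonical c′ → SameProfile c c′ → c ≡ c′
  profile-injective (single _)     (single _)     canon canon′ same = single-profile-injective canon canon′ same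
  profile-injective (single _)     (apart _ _ _)  canon canon′ same = ⊥-elim (single≉apart canon canon′ same)
  profile-injective (single _)     (nested _ _ _) canon canon′ same = ⊥-elim (single≉nested canon canon′ same)
  profile-injective (apart _ _ _)  (single _)     canon canon′ same = ⊥-elim (single≉apart canon′ canon (sym ∘₂ same))
  profile-injective (apart _ _ _)  (apart _ _ _)  canon canon′ same = apart-profile-injective canon canon′ same
  profile-injective (apart _ _ _)  (nested _ _ _) canon canon′ same = ⊥-elim (apart≉nested canon canon′ same)
  profile-injective (nested _ _ _) (single _)     canon canon′ same = ⊥-elim (single≉nested canon′ canon (sym ∘₂ same))
  profile-injective (nested _ _ _) (apart _ _ _)  canon canon′ same = ⊥-elim (apart≉nested canon′ canon (sym ∘₂ same))
  profile-injective (nested _ _ _) (nested _ _ _) canon canon′ same = nested-profile-injective canon canon′ same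

sumUpTo : (ℕ → ℕ) → ℕ → ℕ
sumUpTo f n = sum (applyUpTo f n)

length-upTo-⊗ : ∀ n (f : ℕ → List B) → length (upTo n ⊗ f) ≡ sumUpTo (length ∘ f) n
length-upTo-⊗ n f = trans (length-⊗ (upTo n) f) (cong sum (map-upTo (length ∘ f) n))

sumUpTo-cong : ∀ {f g} n → (∀ i → f i ≡ g i) → sumUpTo f n ≡ sumUpTo g n
sumUpTo-cong zero    f≗g = refl
sumUpTo-cong (suc n) f≗g = cong₂ _+_ (f≗g 0) (sumUpTo-cong n (f≗g ∘ suc))

sumUpTo-snoc : ∀ f n → sumUpTo f (suc n) ≡ sumUpTo f n + f n
sumUpTo-snoc f zero    = +-comm (f 0) 0
sumUpTo-snoc f (suc n) = trans (cong (f 0 +_) (sumUpTo-snoc (f ∘ suc) n)) (sym (+-assoc (f 0) _ _))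

sumUpTo-const : ∀ c n → sumUpTo (λ _ → c) n ≡ n * c
sumUpTo-const c zero    = refl
sumUpTo-const c (suc n) = cong (c +_) (sumUpTo-const c n)

sumUpTo-*ʳ : ∀ f c n → sumUpTo (λ i → f i * c) n ≡ sumUpTo f n * c
sumUpTo-*ʳ f c zero    = refl
sumUpTo-*ʳ f c (suc n) = trans (cong (f 0 * c +_) (sumUpTo-*ʳ (f ∘ suc) c n)) (sym (*-distribʳ-+ c (f 0) _))

sumUpTo-arithmetic : ∀ c n → 2 * sumUpTo (c +_) n + n ≡ n * (2 * c + n)
sumUpTo-arithmetic c zero    = refl
sumUpTo-arithmetic c (suc n) = begin
  2 * sumUpTo (c +_) (suc n) + suc n          ≡⟨ cong (λ s → 2 * s + suc n) (sumUpTo-snoc (c +_) n) ⟩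
  2 * (sumUpTo (c +_) n + (c + n)) + suc n    ≡⟨ step (sumUpTo (c +_) n) c n ⟩
  (2 * sumUpTo (c +_) n + n) + (2 * c + 2 * n + 1) ≡⟨ cong (_+ (2 * c + 2 * n + 1)) (sumUpTo-arithmetic c n) ⟩
  n * (2 * c + n) + (2 * c + 2 * n + 1)       ≡⟨ close c n ⟩
  suc n * (2 * c + suc n)                     ∎
  where
  open ≡-Reasoning
  step : ∀ s c n → 2 * (s + (c + n)) + suc n ≡ (2 * s + n) + (2 * c + 2 * n + 1)
  step = solve-∀
  close : ∀ c n → n * (2 * c + n) + (2 * c + 2 * n + 1) ≡ suc n * (2 * c + suc n)
  close = solve-∀

apart-count : ℕ → ℕ → ℕ
apart-count A G = sumUpTo (λ p → sumUpTo (λ q → p + q + 2) G) A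

apart-count-closed : ∀ A G → 2 * apart-count A G ≡ A * G * (A + G + 2)
apart-count-closed zero    G = refl
apart-count-closed (suc A) G = +-cancelʳ-≡ G _ _ (begin
  2 * apart-count (suc A) G + G                       ≡⟨ cong (λ s → 2 * s + G) (sumUpTo-snoc _ A) ⟩
  2 * (apart-count A G + row) + G                     ≡⟨ split (apart-count A G) row G ⟩
  2 * apart-count A G + (2 * row + G)                 ≡⟨ cong₂ _+_ (apart-count-closed A G) row-closed ⟩
  A * G * (A + G + 2) + G * (2 * (A + 2) + G)         ≡⟨ close A G ⟩
  suc A * G * (suc A + G + 2) + G                     ∎)
  where
  open ≡-Reasoning
  row : ℕ
  row = sumUpTo (λ q → A + q + 2) G
  row-closed : 2 * row + G ≡ G * (2 * (A + 2) + G)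
  row-closed = trans (cong (λ s → 2 * s + G) (sumUpTo-cong G (λ q → shift A q))) (sumUpTo-arithmetic (A + 2) G)
    where
    shift : ∀ A q → A + q + 2 ≡ A + 2 + q
    shift = solve-∀
  split : ∀ a r g → 2 * (a + r) + g ≡ 2 * a + (2 * r + g)
  split = solve-∀
  close : ∀ A G → A * G * (A + G + 2) + G * (2 * (A + 2) + G) ≡ suc A * G * (suc A + G + 2) + G
  close = solve-∀

nested-count : ℕ → ℕ
nested-count L = sumUpTo (λ i → L ∸ suc (i + i)) L

nested-count-step : ∀ L → nested-count (suc (suc L)) ≡ suc L + nested-count L
nested-count-step L = cong (suc L +_) (begin
  sumUpTo (λ i → L ∸ (i + suc i)) (suc L)      ≡⟨ sumUpTo-cong (suc L) (λ i → cong (L ∸_) (+-suc i i)) ⟩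
  sumUpTo (λ i → L ∸ suc (i + i)) (suc L)      ≡⟨ sumUpTo-snoc _ L ⟩
  nested-count L + (L ∸ suc (L + L))           ≡⟨ cong (nested-count L +_) (m≤n⇒m∸n≡0 (m≤n+m L (suc L))) ⟩
  nested-count L + 0                           ≡⟨ +-identityʳ _ ⟩
  nested-count L                               ∎)
  where open ≡-Reasoning

nested-count-even : ∀ h → nested-count (2 * h) ≡ h * h
nested-count-even zero    = refl
nested-count-even (suc h) = begin
  nested-count (2 * suc h)            ≡⟨ cong nested-count (double-suc h) ⟩
  nested-count (suc (suc (2 * h)))    ≡⟨ nested-count-step (2 * h) ⟩
  suc (2 * h) + nested-count (2 * h)  ≡⟨ cong (suc (2 * h) +_) (nested-count-even h) ⟩
  suc (2 * h) + h * h                 ≡⟨ close h ⟩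
  suc h * suc h                       ∎
  where
  open ≡-Reasoning
  double-suc : ∀ h → 2 * suc h ≡ suc (suc (2 * h))
  double-suc = solve-∀
  close : ∀ h → suc (2 * h) + h * h ≡ suc h * suc h
  close = solve-∀

nested-count-odd : ∀ h → nested-count (2 * h + 1) ≡ h * suc h
nested-count-odd zero    = refl
nested-count-odd (suc h) = begin
  nested-count (2 * suc h + 1)                ≡⟨ cong nested-count (double-suc h) ⟩
  nested-count (suc (suc (2 * h + 1)))        ≡⟨ nested-count-step (2 * h + 1) ⟩
  suc (2 * h + 1) + nested-count (2 * h + 1)  ≡⟨ cong (suc (2 * h + 1) +_) (nested-count-odd h) ⟩
  suc (2 * h + 1) + h * suc h                 ≡⟨ close h ⟩
  suc h * suc (suc h)                         ∎
  where
  open ≡-Reasoning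
  double-suc : ∀ h → 2 * suc h + 1 ≡ suc (suc (2 * h + 1))
  double-suc = solve-∀
  close : ∀ h → suc (2 * h + 1) + h * suc h ≡ suc h * suc (suc h)
  close = solve-∀

abelian-complexity-by-enumeration :
  ∀ {S : Set} m n (vector : S → List ℕ) (xs : List S) → Unique xs →
  (∀ {c c′} → c ∈ xs → c′ ∈ xs → vector c ≡ vector c′ → c ≡ c′) →
  (∀ i → ∃ λ c → c ∈ xs × parikh m (factor m i n) ≡ vector c) →
  (∀ {c} → c ∈ xs → ∃ λ i → parikh m (factor m i n) ≡ vector c) →
  HasAbelianComplexity m n (length xs)
abelian-complexity-by-enumeration m n vector xs unique injective covers realised =
    map vector xs
  , length-map vector xs
  , map-unique injective unique
  , (λ i → let c , c∈xs , parikh≡ = covers i in subst (_∈ map vector xs) (sym parikh≡) (∈-map⁺ vector c∈xs))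
  , AllP.map⁺ (All.tabulate realised)

<∸⇒+< : ∀ {a b c} → a < b ∸ c → a + c < b
<∸⇒+< {a} {b} {c} a<b∸c = m≤o∸n⇒m+n≤o (suc a) (<⇒≤ (m∸n≢0⇒n<m (λ b∸c≡0 → n≮0 (subst (a <_) b∸c≡0 a<b∸c)))) a<b∸c

+<⇒<∸ : ∀ {a b c} → a + c < b → a < b ∸ c
+<⇒<∸ {a} = m+n≤o⇒m≤o∸n (suc a)

module Enumeration (k ℓ : ℕ) (1≤ℓ : 1 ≤ ℓ) (ℓ<m : ℓ < suc (suc k)) where
  open Boundaries k ℓ 1≤ℓ ℓ<m public

  apart′ nested′ : ℕ × ℕ × ℕ → Shape
  apart′  (p , q , s) = apart p q s
  nested′ (i , o , s) = nested i o s

  apart-triples nested-triples : List (ℕ × ℕ × ℕ)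
  apart-triples  = upTo (ℓ ∸ 1) ⊗ λ p → upTo (m ∸ suc ℓ) ⊗ λ q → upTo (p + q + 2)
  nested-triples = upTo ℓ ⊗ λ i → upTo (ℓ ∸ suc (i + i)) ⊗ λ _ → upTo m

  shapes : List Shape
  shapes = map single (upTo m) ++ map apart′ apart-triples ++ map nested′ nested-triples

  canonical⇒∈shapes : ∀ c → Canonical c → c ∈ shapes
  canonical⇒∈shapes (single s) s<m = ∈-++⁺ˡ (∈-map⁺ single (∈-upTo⁺ s<m))
  canonical⇒∈shapes (apart p q s) (β<ℓ , ℓ+q<m , s<) = ∈-++⁺ʳ (map single (upTo m)) (∈-++⁺ˡ (∈-map⁺ apart′
    (∈-⊗⁺ (∈-upTo⁺ (+<⇒<∸ (subst (_< ℓ) (+-comm 1 p) β<ℓ)))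
      (∈-⊗⁺ (∈-upTo⁺ (+<⇒<∸ (subst (_< m) (sym (+-comm q (suc ℓ))) ℓ+q<m))) (∈-upTo⁺ s<)))))
  canonical⇒∈shapes (nested i o s) (fits , s<m) = ∈-++⁺ʳ (map single (upTo m)) (∈-++⁺ʳ (map apart′ apart-triples) (∈-map⁺ nested′
    (∈-⊗⁺ (∈-upTo⁺ i<ℓ) (∈-⊗⁺ (∈-upTo⁺ (+<⇒<∸ fits)) (∈-upTo⁺ s<m)))))
    where
    i<ℓ : i < ℓ
    i<ℓ = ≤-<-trans (≤-trans (m≤m+n i i) (≤-trans (n≤1+n _) (m≤n+m _ o))) fits

  ∈shapes⇒canonical : ∀ {c} → c ∈ shapes → Canonical c
  ∈shapes⇒canonical c∈ with ∈-++⁻ (map single (upTo m)) c∈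
  ... | inj₁ c∈singles with ∈-map⁻ single c∈singles
  ...   | s , s∈ , refl = ∈-upTo⁻ s∈
  ∈shapes⇒canonical c∈ | inj₂ c∈rest with ∈-++⁻ (map apart′ apart-triples) c∈rest
  ... | inj₁ c∈aparts with ∈-map⁻ apart′ c∈aparts
  ...   | (p , q , s) , t∈ , refl with ∈-⊗⁻ (upTo (ℓ ∸ 1)) t∈
  ...     | p∈ , qs∈ with ∈-⊗⁻ (upTo (m ∸ suc ℓ)) qs∈
  ...       | q∈ , s∈ = subst (_< ℓ) (+-comm p 1) (<∸⇒+< (∈-upTo⁻ p∈))
                      , subst (_< m) (+-comm q (suc ℓ)) (<∸⇒+< (∈-upTo⁻ q∈))
                      , ∈-upTo⁻ s∈
  ∈shapes⇒canonical c∈ | inj₂ c∈rest | inj₂ c∈nesteds with ∈-map⁻ nested′ c∈nesteds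
  ... | (i , o , s) , t∈ , refl with ∈-⊗⁻ (upTo ℓ) t∈
  ...   | _ , os∈ with ∈-⊗⁻ (upTo (ℓ ∸ suc (i + i))) os∈
  ...     | o∈ , s∈ = <∸⇒+< (∈-upTo⁻ o∈) , ∈-upTo⁻ s∈

  shapes-unique : Unique shapes
  shapes-unique = Unique.++⁺ (Unique.map⁺ single-injective (Unique.upTo⁺ m))
    (Unique.++⁺ (Unique.map⁺ apart′-injective
                  (⊗-unique (Unique.upTo⁺ (ℓ ∸ 1)) λ p → ⊗-unique (Unique.upTo⁺ (m ∸ suc ℓ)) λ q → Unique.upTo⁺ (p + q + 2)))
                (Unique.map⁺ nested′-injective
                  (⊗-unique (Unique.upTo⁺ ℓ) λ i → ⊗-unique (Unique.upTo⁺ (ℓ ∸ suc (i + i))) λ _ → Unique.upTo⁺ m))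
                apart-nested-disjoint)
    single-other-disjoint
    where
    single-injective : ∀ {s s′} → single s ≡ single s′ → s ≡ s′
    single-injective refl = refl
    apart′-injective : ∀ {t t′} → apart′ t ≡ apart′ t′ → t ≡ t′
    apart′-injective {_ , _ , _} {_ , _ , _} refl = refl
    nested′-injective : ∀ {t t′} → nested′ t ≡ nested′ t′ → t ≡ t′
    nested′-injective {_ , _ , _} {_ , _ , _} refl = refl
    apart-nested-disjoint : ∀ {c} → ¬ (c ∈ map apart′ apart-triples × c ∈ map nested′ nested-triples)
    apart-nested-disjoint (c∈aparts , c∈nesteds) with ∈-map⁻ apart′ c∈aparts | ∈-map⁻ nested′ c∈nesteds
    ... | (_ , _ , _) , _ , refl | (_ , _ , _) , _ , ()
    single-other-disjoint : ∀ {c} → ¬ (c ∈ map single (upTo m) × c ∈ map apart′ apart-triples ++ map nested′ nested-triples)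
    single-other-disjoint (c∈singles , c∈rest) with ∈-map⁻ single c∈singles | ∈-++⁻ (map apart′ apart-triples) c∈rest
    ... | _ , _ , refl | inj₁ c∈aparts with ∈-map⁻ apart′ c∈aparts
    ...   | (_ , _ , _) , _ , ()
    single-other-disjoint (c∈singles , c∈rest) | _ , _ , refl | inj₂ c∈nesteds with ∈-map⁻ nested′ c∈nesteds
    ...   | (_ , _ , _) , _ , ()

  length-shapes : length shapes ≡ m + (apart-count (ℓ ∸ 1) (m ∸ suc ℓ) + nested-count ℓ * m)
  length-shapes = begin
    length shapes
      ≡⟨ length-++ (map single (upTo m)) ⟩
    length (map single (upTo m)) + length (map apart′ apart-triples ++ map nested′ nested-triples)
      ≡⟨ cong₂ _+_ (trans (length-map single (upTo m)) (length-upTo m)) (length-++ (map apart′ apart-triples)) ⟩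
    m + (length (map apart′ apart-triples) + length (map nested′ nested-triples))
      ≡⟨ cong (m +_) (cong₂ _+_ (trans (length-map apart′ apart-triples) aparts) (trans (length-map nested′ nested-triples) nesteds)) ⟩
    m + (apart-count (ℓ ∸ 1) (m ∸ suc ℓ) + nested-count ℓ * m)
      ∎
    where
    open ≡-Reasoning
    aparts : length apart-triples ≡ apart-count (ℓ ∸ 1) (m ∸ suc ℓ)
    aparts = trans (length-upTo-⊗ (ℓ ∸ 1) _) (sumUpTo-cong (ℓ ∸ 1) λ p →
               trans (length-upTo-⊗ (m ∸ suc ℓ) _) (sumUpTo-cong (m ∸ suc ℓ) λ q → length-upTo (p + q + 2)))
    nesteds : length nested-triples ≡ nested-count ℓ * m
    nesteds = trans (length-upTo-⊗ ℓ _) (trans (sumUpTo-cong ℓ λ i →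
                trans (length-upTo-⊗ (ℓ ∸ suc (i + i)) _) (trans (sumUpTo-cong (ℓ ∸ suc (i + i)) λ _ → length-upTo m) (sumUpTo-const m (ℓ ∸ suc (i + i)))))
                (sumUpTo-*ʳ (λ i → ℓ ∸ suc (i + i)) m ℓ))

  vector : Shape → List ℕ
  vector c = map (profile c) (upTo m)

  vector⇒SameProfile : ∀ c c′ → vector c ≡ vector c′ → SameProfile c c′
  vector⇒SameProfile c c′ eq a a<m = begin
    profile c a                          ≡⟨ nth-applyUpTo (profile c) a<m ⟨
    nth (applyUpTo (profile c) m) a      ≡⟨ cong (λ v → nth v a) (trans (sym (map-upTo (profile c) m)) (trans eq (map-upTo (profile c′) m))) ⟩
    nth (applyUpTo (profile c′) m) a     ≡⟨ nth-applyUpTo (profile c′) a<m ⟩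
    profile c′ a                         ∎
    where open ≡-Reasoning

  realise : ∀ c → Canonical c → ∃ λ i → ∀ a → count a (factor m i ℓ) ≡ profile c a
  realise (single s) s<m with realise-two-arcs s 0 ℓ 0 (<⇒≤ ℓ<m) z≤n
  ... | i , count≡ = i , λ a → trans (cong (λ n → count a (factor m i n)) (sym (+-identityʳ ℓ))) (trans (count≡ a) (+-identityʳ _))
  realise (apart p q s) canon with realise-two-arcs s (s + distance p q) (ℓ ∸ suc p) (suc p) (<⇒≤ α<m) (<⇒≤ (<-trans β<ℓ ℓ<m))
    where open ApartBounds (apart-bounds p q s canon)
  ... | i , count≡ = i , λ a → trans (cong (λ n → count a (factor m i n)) (sym (m∸n+n≡m (<⇒≤ (proj₁ canon))))) (count≡ a)
  realise (nested i o s) canon with realise-two-arcs s (s + o) (ℓ ∸ suc i) (suc i) (<⇒≤ u<m) (<⇒≤ (≤-<-trans w≤ℓ ℓ<m))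
    where open NestedBounds (nested-bounds i o s canon)
  ... | j , count≡ = j , λ a → trans (cong (λ n → count a (factor m j n)) (sym (NestedBounds.u+w≡ℓ (nested-bounds i o s canon)))) (count≡ a)

  shapes-complexity : HasAbelianComplexity m ℓ (length shapes)
  shapes-complexity = abelian-complexity-by-enumeration m ℓ vector shapes shapes-unique
    (λ {c} {c′} c∈ c′∈ eq → profile-injective c c′ (∈shapes⇒canonical c∈) (∈shapes⇒canonical c′∈) (vector⇒SameProfile c c′ eq))
    (λ i → let c , canon , count≡ = factor-normal i in c , canonical⇒∈shapes c canon , map-cong count≡ (upTo m))
    (λ {c} c∈ → let i , count≡ = realise c (∈shapes⇒canonical c∈) in i , map-cong count≡ (upTo m))

open import Data.Integer using (ℤ; +_) renaming (_+_ to _+ℤ_; _*_ to _*ℤ_; _-_ to _-ℤ_)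
import Data.Integer.Properties as ℤ
import Data.Integer.Tactic.RingSolver as ℤ-Solver

twice-count-ℤ : ℤ → ℤ → ℤ → ℤ
twice-count-ℤ M L T = + 2 *ℤ M +ℤ (L -ℤ + 1) *ℤ (M -ℤ L -ℤ + 1) *ℤ M +ℤ + 2 *ℤ T *ℤ M

pos-∸ : ∀ {a b} → b ≤ a → + (a ∸ b) ≡ + a -ℤ + b
pos-∸ {a} {b} b≤a = trans (sym (ℤ.⊖-≥ b≤a)) (sym (ℤ.m-n≡m⊖n a b))

pos-*₃ : ∀ a b c → + (a * b * c) ≡ + a *ℤ + b *ℤ + c
pos-*₃ a b c = trans (ℤ.pos-* (a * b) c) (cong (_*ℤ + c) (ℤ.pos-* a b))

twice-count : ∀ {m ℓ b T} → 1 ≤ ℓ → ℓ < m → b ≡ m + (apart-count (ℓ ∸ 1) (m ∸ suc ℓ) + T * m) →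
              + 2 *ℤ + b ≡ twice-count-ℤ (+ m) (+ ℓ) (+ T)
twice-count {m} {ℓ} {b} {T} 1≤ℓ ℓ<m refl = begin
  + 2 *ℤ + b
    ≡⟨ ℤ.pos-* 2 b ⟨
  + (2 * b)
    ≡⟨ cong +_ doubled ⟩
  + (2 * m + splits * gaps * m + 2 * T * m)
    ≡⟨ cast ⟩
  + 2 *ℤ + m +ℤ + splits *ℤ + gaps *ℤ + m +ℤ + 2 *ℤ + T *ℤ + m
    ≡⟨ cong₂ (λ a g → + 2 *ℤ + m +ℤ a *ℤ g *ℤ + m +ℤ + 2 *ℤ + T *ℤ + m)
             (pos-∸ 1≤ℓ) (trans (pos-∸ ℓ<m) (cong (+ m -ℤ_) (ℤ.pos-+ 1 ℓ))) ⟩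
  + 2 *ℤ + m +ℤ (+ ℓ -ℤ + 1) *ℤ (+ m -ℤ (+ 1 +ℤ + ℓ)) *ℤ + m +ℤ + 2 *ℤ + T *ℤ + m
    ≡⟨ regroup (+ m) (+ ℓ) (+ T) ⟩
  twice-count-ℤ (+ m) (+ ℓ) (+ T)
    ∎
  where
  open ≡-Reasoning
  splits gaps : ℕ
  splits = ℓ ∸ 1
  gaps = m ∸ suc ℓ
  lengths : splits + gaps + 2 ≡ m
  lengths = begin
    splits + gaps + 2          ≡⟨ rearrange splits gaps ⟩
    gaps + suc (splits + 1)    ≡⟨ cong (λ z → gaps + suc z) (m∸n+n≡m 1≤ℓ) ⟩
    gaps + suc ℓ               ≡⟨ m∸n+n≡m ℓ<m ⟩
    m                          ∎
    where
    rearrange : ∀ a g → a + g + 2 ≡ g + suc (a + 1)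
    rearrange = solve-∀
  doubled : 2 * (m + (apart-count splits gaps + T * m)) ≡ 2 * m + splits * gaps * m + 2 * T * m
  doubled = begin
    2 * (m + (apart-count splits gaps + T * m))
      ≡⟨ distribute m (apart-count splits gaps) T ⟩
    2 * m + 2 * apart-count splits gaps + 2 * T * m
      ≡⟨ cong (λ z → 2 * m + z + 2 * T * m) (apart-count-closed splits gaps) ⟩
    2 * m + splits * gaps * (splits + gaps + 2) + 2 * T * m
      ≡⟨ cong (λ z → 2 * m + splits * gaps * z + 2 * T * m) lengths ⟩
    2 * m + splits * gaps * m + 2 * T * m
      ∎
    where
    distribute : ∀ m B T → 2 * (m + (B + T * m)) ≡ 2 * m + 2 * B + 2 * T * m
    distribute = solve-∀
  cast : + (2 * m + splits * gaps * m + 2 * T * m) ≡ + 2 *ℤ + m +ℤ + splits *ℤ + gaps *ℤ + m +ℤ + 2 *ℤ + T *ℤ + m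
  cast = trans (ℤ.pos-+ _ (2 * T * m))
    (cong₂ _+ℤ_ (trans (ℤ.pos-+ (2 * m) _) (cong₂ _+ℤ_ (ℤ.pos-* 2 m) (pos-*₃ splits gaps m))) (pos-*₃ 2 T m))
  regroup : ∀ M L T → + 2 *ℤ M +ℤ (L -ℤ + 1) *ℤ (M -ℤ (+ 1 +ℤ L)) *ℤ M +ℤ + 2 *ℤ T *ℤ M
                      ≡ + 2 *ℤ M +ℤ (L -ℤ + 1) *ℤ (M -ℤ L -ℤ + 1) *ℤ M +ℤ + 2 *ℤ T *ℤ M
  regroup = ℤ-Solver.solve-∀

odd-formula : ∀ {m ℓ} b h → + 2 *ℤ + b ≡ twice-count-ℤ (+ m) (+ ℓ) (+ nested-count ℓ) → ℓ ≡ 2 * h + 1 →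
              + b ≡ + m *ℤ (+ 1 -ℤ + h -ℤ + h *ℤ + h +ℤ + h *ℤ + m)
odd-formula {m} b h twice refl = ℤ.*-cancelˡ-≡ (+ 2) _ _ (begin
  + 2 *ℤ + b                                                             ≡⟨ twice ⟩
  twice-count-ℤ (+ m) (+ (2 * h + 1)) (+ nested-count (2 * h + 1))       ≡⟨ cong₂ (twice-count-ℤ (+ m)) ℓ-cast T-cast ⟩
  twice-count-ℤ (+ m) (+ 2 *ℤ + h +ℤ + 1) (+ h *ℤ (+ 1 +ℤ + h))          ≡⟨ identity (+ m) (+ h) ⟩
  + 2 *ℤ (+ m *ℤ (+ 1 -ℤ + h -ℤ + h *ℤ + h +ℤ + h *ℤ + m))               ∎)
  where
  open ≡-Reasoning
  ℓ-cast : + (2 * h + 1) ≡ + 2 *ℤ + h +ℤ + 1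
  ℓ-cast = trans (ℤ.pos-+ (2 * h) 1) (cong (_+ℤ + 1) (ℤ.pos-* 2 h))
  T-cast : + nested-count (2 * h + 1) ≡ + h *ℤ (+ 1 +ℤ + h)
  T-cast = trans (cong +_ (nested-count-odd h)) (trans (ℤ.pos-* h (suc h)) (cong (+ h *ℤ_) (ℤ.pos-+ 1 h)))
  identity : ∀ M H → + 2 *ℤ M +ℤ (+ 2 *ℤ H +ℤ + 1 -ℤ + 1) *ℤ (M -ℤ (+ 2 *ℤ H +ℤ + 1) -ℤ + 1) *ℤ M +ℤ + 2 *ℤ (H *ℤ (+ 1 +ℤ H)) *ℤ M
                     ≡ + 2 *ℤ (M *ℤ (+ 1 -ℤ H -ℤ H *ℤ H +ℤ H *ℤ M))
  identity = ℤ-Solver.solve-∀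

even-formula : ∀ {m ℓ} b h → + 2 *ℤ + b ≡ twice-count-ℤ (+ m) (+ ℓ) (+ nested-count ℓ) → ℓ ≡ 2 * h →
               + 4 *ℤ + b ≡ + m *ℤ (+ 6 -ℤ + ℓ *ℤ + ℓ -ℤ + 2 *ℤ + m +ℤ + 2 *ℤ + ℓ *ℤ + m)
even-formula {m} b h twice refl = begin
  + 4 *ℤ + b                                                             ≡⟨ double (+ b) ⟩
  + 2 *ℤ (+ 2 *ℤ + b)                                                    ≡⟨ cong (+ 2 *ℤ_) twice ⟩
  + 2 *ℤ twice-count-ℤ (+ m) (+ (2 * h)) (+ nested-count (2 * h))        ≡⟨ cong₂ (λ L T → + 2 *ℤ twice-count-ℤ (+ m) L T) ℓ-cast T-cast ⟩
  + 2 *ℤ twice-count-ℤ (+ m) (+ 2 *ℤ + h) (+ h *ℤ + h)                   ≡⟨ identity (+ m) (+ h) ⟩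
  + m *ℤ (+ 6 -ℤ L *ℤ L -ℤ + 2 *ℤ + m +ℤ + 2 *ℤ L *ℤ + m)               ≡⟨ cong (λ z → + m *ℤ (+ 6 -ℤ z *ℤ z -ℤ + 2 *ℤ + m +ℤ + 2 *ℤ z *ℤ + m)) ℓ-cast ⟨
  + m *ℤ (+ 6 -ℤ + (2 * h) *ℤ + (2 * h) -ℤ + 2 *ℤ + m +ℤ + 2 *ℤ + (2 * h) *ℤ + m) ∎
  where
  open ≡-Reasoning
  L : ℤ
  L = + 2 *ℤ + h
  ℓ-cast : + (2 * h) ≡ + 2 *ℤ + h
  ℓ-cast = ℤ.pos-* 2 h
  T-cast : + nested-count (2 * h) ≡ + h *ℤ + h
  T-cast = trans (cong +_ (nested-count-even h)) (ℤ.pos-* h h)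
  double : ∀ B → + 4 *ℤ B ≡ + 2 *ℤ (+ 2 *ℤ B)
  double = ℤ-Solver.solve-∀
  identity : ∀ M H → + 2 *ℤ (+ 2 *ℤ M +ℤ (+ 2 *ℤ H -ℤ + 1) *ℤ (M -ℤ + 2 *ℤ H -ℤ + 1) *ℤ M +ℤ + 2 *ℤ (H *ℤ H) *ℤ M)
                     ≡ M *ℤ (+ 6 -ℤ (+ 2 *ℤ H) *ℤ (+ 2 *ℤ H) -ℤ + 2 *ℤ M +ℤ + 2 *ℤ (+ 2 *ℤ H) *ℤ M)
  identity = ℤ-Solver.solve-∀

proposition8p1 : (m ℓ : ℕ) → 2 ≤ m → 1 ≤ ℓ → ℓ < m →
    Σ ℕ λ b → HasAbelianComplexity m ℓ b
      × ((ℓ′ : ℕ) → ℓ ≡ 2 * ℓ′ + 1 →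
          + b ≡ + m *ℤ (+ 1 -ℤ + ℓ′ -ℤ + ℓ′ *ℤ + ℓ′ +ℤ + ℓ′ *ℤ + m))
      × ((h : ℕ) → ℓ ≡ 2 * h →
          + 4 *ℤ + b ≡ + m *ℤ (+ 6 -ℤ + ℓ *ℤ + ℓ -ℤ + 2 *ℤ + m +ℤ + 2 *ℤ + ℓ *ℤ + m))
proposition8p1 m ℓ (s≤s (s≤s {n = k} z≤n)) 1≤ℓ ℓ<m =
  length shapes , shapes-complexity , (λ h → odd-formula (length shapes) h twice) , (λ h → even-formula (length shapes) h twice)
  where
  open Enumeration k ℓ 1≤ℓ ℓ<m using (shapes; shapes-complexity; length-shapes)
  twice : + 2 *ℤ + length shapes ≡ twice-count-ℤ (+ m) (+ ℓ) (+ nested-count ℓ)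
  twice = twice-count {T = nested-count ℓ} 1≤ℓ ℓ<m length-shapes
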